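{- Let $G$ be a simple graph, $s$ a word over $V(G)$ and $u\in V(G)$. Then there exists a word $s'\in \mathrm{Loc}_G(s)$ which is reduced with respect to $G$, satisfies $V(s')\subseteq V(s)$, and in which every occurrence of $u$ (if any) is at position 1 or position 2.
   Context: For a simple graph $G$ and $u\in V(G)$, the local complement $Gu$ is the graph on $V(G)$ with edge set $E(G)\triangle\{[x,y]:x\ne y,\ x,y\in N_G(u)\}$; for a word $s=u_1\cdots u_k$ over $V(G)$, $Gs=(\cdots(Gu_1)\cdots)u_k$ and $G\epsilon=G$ for the empty word. $V(s)$ is the set of letters of $s$. A word $s$ is reduced with respect to $G$ if $s=s_1\cdots s_n$ ($n\ge0$) where the letter sets of the blocks $s_i$ are pairwise disjoint and each $s_i$ is either a single vertex or a word $uvu$ with $u\ne v$ and $[u,v]\in E(Gs_1\cdots s_{i-1})$. $\mathrm{Loc}_G(s)$ is the set of words obtainable from $s$ by finitely many steps, each of which replaces a word $prq$ by $pq$ or a word $pq$ by $prq$ (for words $p,q$), where, with $H=Gp$, the factor $r$ is one of: $uu$ ($u\in V(G)$); $uvuv$ with $u\ne v$ non-adjacent in $H$; $uvuvuv$ with $[u,v]\in E(H)$; $uvuvwvuwu$ with $u,v,w$ pairwise adjacent in $H$. -}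

module Defs where

open import Data.Nat using (ℕ; _<_)
open import Data.Fin using (Fin; toℕ; _≟_)
open import Data.Bool using (Bool; true; false; not; _∧_; _xor_)
open import Data.List using (List; []; _∷_; _++_; foldl; concat; map; length; lookup)
open import Data.List.Relation.Unary.AllPairs using (AllPairs)
open import Data.List.Relation.Binary.Disjoint.Propositional using (Disjoint)
open import Data.Product using (_×_; Σ; _,_)
open import Data.Unit using (⊤)
open import Relation.Nullary using (¬_)
open import Relation.Nullary.Decidable using (⌊_⌋)
open import Relation.Binary.PropositionalEquality using (_≡_)
open import Relation.Binary.Construct.Closure.ReflexiveTransitive using (Star)

Graph : ℕ → Set
Graph n = Fin n → Fin n → Bool

IsSimple : ∀ {n} → Graph n → Set
IsSimple {n} G = (∀ (x y : Fin n) → G x y ≡ G y x) × (∀ (x : Fin n) → G x x ≡ false)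

Word : ℕ → Set
Word n = List (Fin n)

lc : ∀ {n} → Graph n → Fin n → Graph n
lc G u x y = G x y xor (not ⌊ x ≟ y ⌋ ∧ (G u x ∧ G u y))

_·_ : ∀ {n} → Graph n → Word n → Graph n
G · s = foldl lc G s

data Relator {n} (H : Graph n) : Word n → Set where
  r-uu     : ∀ u → Relator H (u ∷ u ∷ [])
  r-uvuv   : ∀ u v → ¬ (u ≡ v) → H u v ≡ false → Relator H (u ∷ v ∷ u ∷ v ∷ [])
  r-uvuvuv : ∀ u v → H u v ≡ true → Relator H (u ∷ v ∷ u ∷ v ∷ u ∷ v ∷ [])
  r-9      : ∀ u v w → H u v ≡ true → H v w ≡ true → H u w ≡ true →
             Relator H (u ∷ v ∷ u ∷ v ∷ w ∷ v ∷ u ∷ w ∷ u ∷ [])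

data Step {n} (G : Graph n) : Word n → Word n → Set where
  delete : ∀ p r q → Relator (G · p) r → Step G (p ++ r ++ q) (p ++ q)
  insert : ∀ p r q → Relator (G · p) r → Step G (p ++ q) (p ++ r ++ q)

-- t ∈ Loc_G(s)  is  Loc G s t.
Loc : ∀ {n} → Graph n → Word n → Word n → Set
Loc G = Star (Step G)

data Block (n : ℕ) : Set where
  single : Fin n → Block n
  triple : Fin n → Fin n → Block n   -- triple u v stands for u v u

blockWord : ∀ {n} → Block n → Word n
blockWord (single u)   = u ∷ []
blockWord (triple u v) = u ∷ v ∷ u ∷ []

BlocksOK : ∀ {n} → Graph n → List (Block n) → Set
BlocksOK G [] = ⊤
BlocksOK G (single u ∷ bs) = BlocksOK (lc G u) bs
BlocksOK G (triple u v ∷ bs) =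
  ¬ (u ≡ v) × G u v ≡ true × BlocksOK (G · (u ∷ v ∷ u ∷ [])) bs

Reduced : ∀ {n} → Graph n → Word n → Set
Reduced {n} G s = Σ (List (Block n)) λ bs →
  (concat (map blockWord bs) ≡ s) ×
  AllPairs Disjoint (map blockWord bs) ×
  BlocksOK G bs

-- Every occurrence of u in s is at (1-indexed) position 1 or 2.
OnlyAtStart : ∀ {n} → Fin n → Word n → Set
OnlyAtStart u s = ∀ (i : Fin (length s)) → lookup s i ≡ u → toℕ i < 2

-- Every relator acts trivially on simple graphs: whether H · r and H agree at x y only
-- depends on the subgraph induced by x, y and the letters of r, so this is a finite check
-- on at most five vertices. Hence Loc G preserves G · s, and the validity of blocks can be
-- transported along Loc.
--
-- A word x t is reduced by reducing t with respect to G x, bringing x into the first two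
-- positions of the result, and merging x with the at most two blocks it then meets. Bringing
-- a vertex u to the front of a reduced word goes block by block from the right, each step
-- merging one block with the at most two blocks containing the front occurrence of u. All
-- these merges involve at most four vertices and are certified, for every simple graph on
-- them, by explicit sequences of relator moves.

module Submission where

open import Defs
open import Data.Nat using (ℕ; zero; suc; s≤s; z≤n)
open import Data.Fin using (Fin; zero; suc; _≟_)
open import Data.Fin.Properties using (any?)
open import Data.Bool using (Bool; true; false; _∧_; T)
import Data.Bool.Properties as Bool
open import Data.Vec as Vec using (Vec; []; _∷_; lookup; tabulate; zipWith)
import Data.Vec.Properties as Vec
open import Data.Vec.Relation.Unary.All using ([]; _∷_)
import Data.Vec.Relation.Unary.All.Properties as VecAll
open import Data.Vec.Relation.Unary.Unique.Propositional using (Unique; []; _∷_)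
open import Data.Vec.Relation.Unary.Unique.Propositional.Properties using (lookup-injective)
open import Data.List using (List; []; _∷_; _++_; foldl; concat; map; reverse; take; drop)
open import Data.List.Properties
  using ( foldl-++; map-++; ++-assoc; concat-++; unfold-reverse; reverse-involutive; map-∘; drop-map
        ; take++drop≡id; ≡-dec)
open import Data.List.Relation.Unary.All as All using (All; []; _∷_; all?)
import Data.List.Relation.Unary.All.Properties as All
open import Data.List.Relation.Unary.AllPairs as AllPairs using (AllPairs; []; _∷_; allPairs?)
import Data.List.Relation.Unary.AllPairs.Properties as AllPairs
open import Data.List.Relation.Unary.Any using (here; there)
open import Data.List.Relation.Binary.Disjoint.Propositional using (Disjoint)
open import Data.List.Membership.Propositional using (_∈_; _∉_)
open import Data.List.Membership.Propositional.Properties using (∈-map⁻; ∈-map⁺; ∈-++⁻; ∈-concat⁺′; ∈-lookup)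
import Data.List.Membership.DecPropositional as DecMembership
open import Data.List.Relation.Binary.Subset.Propositional using (_⊆_)
import Data.List.Relation.Binary.Subset.Propositional.Properties as Subset
import Data.List.Relation.Binary.Subset.DecPropositional as DecSubset
open import Data.Maybe using (Maybe; just; nothing; is-just; to-witness-T)
open import Data.Product using (_×_; Σ; _,_; proj₁; proj₂)
open import Data.Sum using (inj₁; inj₂; [_,_]′)
open import Data.Unit using (⊤; tt)
open import Data.Empty using (⊥-elim)
open import Function using (_∘_; Equivalence)
open import Relation.Nullary using (¬_; Dec; yes; no; ¬?)
open import Relation.Nullary.Decidable using (⌊_⌋; _×-dec_; _→-dec_; map′; T?; toWitness; isYes≗does; dec-true)
open import Relation.Binary.PropositionalEquality
open import Relation.Binary.Construct.Closure.ReflexiveTransitive using (ε; _◅_; _◅◅_)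

private
  variable
    n k : ℕ
    G H : Graph n
    w w′ : Word n

⌊⌋-cong : {A B : Set} (a? : Dec A) (b? : Dec B) → (A → B) → (B → A) → ⌊ a? ⌋ ≡ ⌊ b? ⌋
⌊⌋-cong (yes _) (yes _) _ _ = refl
⌊⌋-cong (no _)  (no _)  _ _ = refl
⌊⌋-cong (yes a) (no ¬b) f _ = ⊥-elim (¬b (f a))
⌊⌋-cong (no ¬a) (yes b) _ g = ⊥-elim (¬a (g b))

⌊≟⌋-refl : (x : Fin n) → ⌊ x ≟ x ⌋ ≡ true
⌊≟⌋-refl x = trans (isYes≗does (x ≟ x)) (dec-true (x ≟ x) refl)

⌊≟⌋-sym : (x y : Fin n) → ⌊ x ≟ y ⌋ ≡ ⌊ y ≟ x ⌋
⌊≟⌋-sym x y = ⌊⌋-cong (x ≟ y) (y ≟ x) sym sym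

adjacent⇒≢ : IsSimple G → ∀ {u v} → G u v ≡ true → ¬ u ≡ v
adjacent⇒≢ (_ , loopless) {u} adj refl with trans (sym adj) (loopless u)
... | ()

infix 4 _≈_
_≈_ : Graph n → Graph n → Set
G ≈ H = ∀ x y → G x y ≡ H x y

≈-refl : G ≈ G
≈-refl _ _ = refl

≈-sym : G ≈ H → H ≈ G
≈-sym G≈H x y = sym (G≈H x y)

≈-trans : {K : Graph n} → G ≈ H → H ≈ K → G ≈ K
≈-trans G≈H H≈K x y = trans (G≈H x y) (H≈K x y)

lc-cong : G ≈ H → ∀ w → lc G w ≈ lc H w
lc-cong G≈H w x y rewrite G≈H x y | G≈H w x | G≈H w y = refl

·-cong : G ≈ H → ∀ p → G · p ≈ H · p
·-cong G≈H []      = G≈H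
·-cong G≈H (w ∷ p) = ·-cong (lc-cong G≈H w) p

·-++ : ∀ (G : Graph n) p q → G · (p ++ q) ≡ (G · p) · q
·-++ = foldl-++ lc

lc-simple : IsSimple G → ∀ w → IsSimple (lc G w)
lc-simple {G = G} (symmetric , loopless) w = symmetric′ , loopless′
  where
  symmetric′ : ∀ x y → lc G w x y ≡ lc G w y x
  symmetric′ x y rewrite symmetric x y | ⌊≟⌋-sym x y | Bool.∧-comm (G w x) (G w y) = refl
  loopless′ : ∀ x → lc G w x x ≡ false
  loopless′ x rewrite loopless x | ⌊≟⌋-refl x = refl

·-simple : IsSimple G → ∀ p → IsSimple (G · p)
·-simple simple []      = simple
·-simple simple (w ∷ p) = ·-simple (lc-simple simple w) p

Relator-cong : G ≈ H → ∀ {r} → Relator G r → Relator H r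
Relator-cong G≈H (r-uu u)               = r-uu u
Relator-cong G≈H (r-uvuv u v u≢v uv)    = r-uvuv u v u≢v (trans (sym (G≈H u v)) uv)
Relator-cong G≈H (r-uvuvuv u v uv)      = r-uvuvuv u v (trans (sym (G≈H u v)) uv)
Relator-cong G≈H (r-9 u v w uv vw uw)   =
  r-9 u v w (trans (sym (G≈H u v)) uv) (trans (sym (G≈H v w)) vw) (trans (sym (G≈H u w)) uw)

Step-cong : G ≈ H → ∀ {s t} → Step G s t → Step H s t
Step-cong G≈H (delete p r q rel) = delete p r q (Relator-cong (·-cong G≈H p) rel)
Step-cong G≈H (insert p r q rel) = insert p r q (Relator-cong (·-cong G≈H p) rel)

Loc-cong : G ≈ H → ∀ {s t} → Loc G s t → Loc H s t
Loc-cong G≈H ε          = ε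
Loc-cong G≈H (st ◅ sts) = Step-cong G≈H st ◅ Loc-cong G≈H sts

Step-prefix : (a : Word n) {s t : Word n} → Step (G · a) s t → Step G (a ++ s) (a ++ t)
Step-prefix {G = G} a (delete p r q rel) =
  subst₂ (Step G) (++-assoc a p (r ++ q)) (++-assoc a p q)
    (delete (a ++ p) r q (subst (λ K → Relator K r) (sym (·-++ G a p)) rel))
Step-prefix {G = G} a (insert p r q rel) =
  subst₂ (Step G) (++-assoc a p q) (++-assoc a p (r ++ q))
    (insert (a ++ p) r q (subst (λ K → Relator K r) (sym (·-++ G a p)) rel))

Loc-prefix : (a : Word n) {s t : Word n} → Loc (G · a) s t → Loc G (a ++ s) (a ++ t)
Loc-prefix a ε          = ε
Loc-prefix a (st ◅ sts) = Step-prefix a st ◅ Loc-prefix a sts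

Step-suffix : (c : Word n) {s t : Word n} → Step G s t → Step G (s ++ c) (t ++ c)
Step-suffix {G = G} c (delete p r q rel) =
  subst₂ (Step G) (sym (trans (++-assoc p (r ++ q) c) (cong (p ++_) (++-assoc r q c)))) (sym (++-assoc p q c))
    (delete p r (q ++ c) rel)
Step-suffix {G = G} c (insert p r q rel) =
  subst₂ (Step G) (sym (++-assoc p q c)) (sym (trans (++-assoc p (r ++ q) c) (cong (p ++_) (++-assoc r q c))))
    (insert p r (q ++ c) rel)

Loc-suffix : (c : Word n) {s t : Word n} → Loc G s t → Loc G (s ++ c) (t ++ c)
Loc-suffix c ε          = ε
Loc-suffix c (st ◅ sts) = Step-suffix c st ◅ Loc-suffix c sts

Loc-insertMirror : (G : Graph n) (a y q : Word n) → Loc G (a ++ q) (a ++ y ++ reverse y ++ q)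
Loc-insertMirror G a []      q = ε
Loc-insertMirror G a (c ∷ y) q =
  subst (Step G (a ++ q)) (sym (++-assoc a (c ∷ []) (c ∷ q))) (insert a (c ∷ c ∷ []) q (r-uu c)) ◅
  subst (Loc G ((a ++ c ∷ []) ++ c ∷ q)) mirror (Loc-insertMirror G (a ++ c ∷ []) y (c ∷ q))
  where
  open ≡-Reasoning
  mirror : (a ++ c ∷ []) ++ y ++ reverse y ++ c ∷ q ≡ a ++ (c ∷ y) ++ reverse (c ∷ y) ++ q
  mirror = begin
      (a ++ c ∷ []) ++ y ++ reverse y ++ c ∷ q
    ≡⟨ ++-assoc a (c ∷ []) _ ⟩
      a ++ c ∷ y ++ reverse y ++ c ∷ q
    ≡⟨ cong (λ z → a ++ c ∷ y ++ z) (sym (++-assoc (reverse y) (c ∷ []) q)) ⟩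
      a ++ c ∷ y ++ (reverse y ++ c ∷ []) ++ q
    ≡⟨ cong (λ z → a ++ c ∷ y ++ z ++ q) (sym (unfold-reverse c y)) ⟩
      a ++ (c ∷ y) ++ reverse (c ∷ y) ++ q ∎

Loc-replaceRelatorPrefix : (G : Graph n) (p x y q : Word n) → Relator (G · p) (x ++ y) →
  Loc G (p ++ x ++ q) (p ++ reverse y ++ q)
Loc-replaceRelatorPrefix G p x y q rel =
  subst₂ (Loc G) (++-assoc p x q) reassoc (Loc-insertMirror G (p ++ x) y q)
  ◅◅ delete p (x ++ y) (reverse y ++ q) rel ◅ ε
  where
  reassoc : (p ++ x) ++ y ++ reverse y ++ q ≡ p ++ (x ++ y) ++ reverse y ++ q
  reassoc = trans (++-assoc p x _) (cong (p ++_) (sym (++-assoc x y _)))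

Loc-replaceRelatorSuffix : (G : Graph n) (p x y q : Word n) → Relator (G · (p ++ reverse y)) (y ++ x) →
  Loc G (p ++ x ++ q) (p ++ reverse y ++ q)
Loc-replaceRelatorSuffix G p x y q rel =
  subst (Loc G (p ++ x ++ q)) unreverse (Loc-insertMirror G p (reverse y) (x ++ q))
  ◅◅ subst₂ (Step G) reassoc (++-assoc p (reverse y) q) (delete (p ++ reverse y) (y ++ x) q rel) ◅ ε
  where
  unreverse : p ++ reverse y ++ reverse (reverse y) ++ x ++ q ≡ p ++ reverse y ++ y ++ x ++ q
  unreverse = cong (λ z → p ++ reverse y ++ z ++ x ++ q) (reverse-involutive y)
  reassoc : (p ++ reverse y) ++ (y ++ x) ++ q ≡ p ++ reverse y ++ y ++ x ++ q
  reassoc = trans (++-assoc p (reverse y) _) (cong (λ z → p ++ reverse y ++ z) (++-assoc y x q))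

-- Restriction to an induced subgraph on distinct vertices

restrict : Graph n → Vec (Fin n) k → Graph k
restrict G vs i j = G (lookup vs i) (lookup vs j)

restrict-simple : IsSimple G → (vs : Vec (Fin n) k) → IsSimple (restrict G vs)
restrict-simple (symmetric , loopless) vs =
  (λ i j → symmetric (lookup vs i) (lookup vs j)) , (λ i → loopless (lookup vs i))

module _ {vs : Vec (Fin n) k} (distinct : Unique vs) where

  private
    ι : Fin k → Fin n
    ι = lookup vs

    injective : ∀ {i j} → ι i ≡ ι j → i ≡ j
    injective = lookup-injective distinct _ _

  restrict-lc : ∀ (G : Graph n) w → restrict (lc G (ι w)) vs ≈ lc (restrict G vs) w
  restrict-lc G w i j rewrite ⌊⌋-cong (ι i ≟ ι j) (i ≟ j) injective (cong ι) = refl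

  restrict-· : ∀ (G : Graph n) p → restrict (G · map ι p) vs ≈ restrict G vs · p
  restrict-· G []      = ≈-refl
  restrict-· G (w ∷ p) = ≈-trans (restrict-· (lc G (ι w)) p) (·-cong (restrict-lc G w) p)

  Relator-embed : ∀ {r} → Relator (restrict H vs) r → Relator H (map ι r)
  Relator-embed (r-uu u)             = r-uu (ι u)
  Relator-embed (r-uvuv u v u≢v uv)  = r-uvuv (ι u) (ι v) (u≢v ∘ injective) uv
  Relator-embed (r-uvuvuv u v uv)    = r-uvuvuv (ι u) (ι v) uv
  Relator-embed (r-9 u v w uv vw uw) = r-9 (ι u) (ι v) (ι w) uv vw uw

  private
    map-++₃ : ∀ (p r q : Word k) → map ι (p ++ r ++ q) ≡ map ι p ++ map ι r ++ map ι q
    map-++₃ p r q = trans (map-++ ι p (r ++ q)) (cong (map ι p ++_) (map-++ ι r q))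

    Relator-embedAfter : ∀ p {r} → Relator (restrict G vs · p) r → Relator (G · map ι p) (map ι r)
    Relator-embedAfter {G = G} p rel = Relator-embed (Relator-cong (≈-sym (restrict-· G p)) rel)

  Step-embed : ∀ {s t} → Step (restrict G vs) s t → Step G (map ι s) (map ι t)
  Step-embed {G = G} (delete p r q rel) =
    subst₂ (Step G) (sym (map-++₃ p r q)) (sym (map-++ ι p q))
      (delete (map ι p) (map ι r) (map ι q) (Relator-embedAfter p rel))
  Step-embed {G = G} (insert p r q rel) =
    subst₂ (Step G) (sym (map-++ ι p q)) (sym (map-++₃ p r q))
      (insert (map ι p) (map ι r) (map ι q) (Relator-embedAfter p rel))

  Loc-embed : ∀ {s t} → Loc (restrict G vs) s t → Loc G (map ι s) (map ι t)
  Loc-embed ε          = ε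
  Loc-embed (st ◅ sts) = Step-embed st ◅ Loc-embed sts

-- Simple graphs on few vertices, by exhaustive enumeration

Table : ℕ → Set
Table k = Vec (Vec Bool k) k

graphOf : Table k → Graph k
graphOf t i j = lookup (lookup t i) j

tableOf : Graph k → Table k
tableOf G = tabulate λ i → tabulate (G i)

graphOf-tableOf : (G : Graph k) → graphOf (tableOf G) ≈ G
graphOf-tableOf G i j =
  trans (cong (λ row → lookup row j) (Vec.lookup∘tabulate _ i)) (Vec.lookup∘tabulate (G i) j)

lcᵀ : Table k → Fin k → Table k
lcᵀ t w = tableOf (lc (graphOf t) w)

infixl 20 _·ᵀ_
_·ᵀ_ : Table k → Word k → Table k
_·ᵀ_ = foldl lcᵀ

graphOf-·ᵀ : (t : Table k) (p : Word k) → graphOf (t ·ᵀ p) ≈ graphOf t · p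
graphOf-·ᵀ t []      = ≈-refl
graphOf-·ᵀ t (w ∷ p) = ≈-trans (graphOf-·ᵀ (lcᵀ t w) p) (·-cong (graphOf-tableOf (lc (graphOf t) w)) p)

-- A simple graph on Fin (suc k) is coded by the adjacency row of vertex 0 followed by
-- the code of the graph induced on the remaining vertices.
Code : ℕ → Set
Code zero    = ⊤
Code (suc k) = Vec Bool k × Code k

tableFromCode : Code k → Table k
tableFromCode {zero}  tt        = []
tableFromCode {suc k} (row , c) = (false ∷ row) ∷ zipWith _∷_ row (tableFromCode c)

shrink : Graph (suc k) → Graph k
shrink G i j = G (suc i) (suc j)

codeOf : Graph k → Code k
codeOf {zero}  G = tt
codeOf {suc k} G = tabulate (G zero ∘ suc) , codeOf (shrink G)

codeBits : Code k → List Bool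
codeBits {zero}  tt        = []
codeBits {suc k} (row , c) = Vec.toList row ++ codeBits c

codeOf-row-suc : (G : Graph (suc k)) (i : Fin k) →
  lookup (tableFromCode (codeOf G)) (suc i) ≡ G zero (suc i) ∷ lookup (tableFromCode (codeOf (shrink G))) i
codeOf-row-suc G i =
  trans (Vec.lookup-zipWith _∷_ i (tabulate (G zero ∘ suc)) (tableFromCode (codeOf (shrink G))))
    (cong (_∷ lookup (tableFromCode (codeOf (shrink G))) i) (Vec.lookup∘tabulate (G zero ∘ suc) i))

codeOf-correct : {G : Graph k} → IsSimple G → G ≈ graphOf (tableFromCode (codeOf G))
codeOf-correct {suc k} (symmetric , loopless) zero zero = loopless zero
codeOf-correct {suc k} {G} _ zero (suc j) = sym (Vec.lookup∘tabulate (G zero ∘ suc) j)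
codeOf-correct {suc k} {G} (symmetric , _) (suc i) zero =
  trans (symmetric (suc i) zero) (sym (cong (λ row → lookup row zero) (codeOf-row-suc G i)))
codeOf-correct {suc k} {G} (symmetric , loopless) (suc i) (suc j) =
  trans (codeOf-correct ((λ i j → symmetric (suc i) (suc j)) , (λ i → loopless (suc i))) i j)
    (sym (cong (λ row → lookup row (suc j)) (codeOf-row-suc G i)))

allVecs : ∀ m → (Vec Bool m → Bool) → Bool
allVecs zero    P = P []
allVecs (suc m) P = allVecs m (P ∘ (true ∷_)) ∧ allVecs m (P ∘ (false ∷_))

allVecs-sound : ∀ m (P : Vec Bool m → Bool) → T (allVecs m P) → ∀ v → T (P v)
allVecs-sound zero    P all []           = all
allVecs-sound (suc m) P all (true ∷ v)   = allVecs-sound m _ (proj₁ (Equivalence.to Bool.T-∧ all)) v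
allVecs-sound (suc m) P all (false ∷ v)  = allVecs-sound m _ (proj₂ (Equivalence.to Bool.T-∧ all)) v

allCodes : (Code k → Bool) → Bool
allCodes {zero}  P = P tt
allCodes {suc k} P = allVecs k λ row → allCodes λ c → P (row , c)

allCodes-sound : (P : Code k → Bool) → T (allCodes P) → ∀ c → T (P c)
allCodes-sound {zero}  P all tt        = all
allCodes-sound {suc k} P all (row , c) =
  allCodes-sound (λ c → P (row , c)) (allVecs-sound k _ all row) c

allCodes-dec-sound : {P : Code k → Set} (P? : ∀ c → Dec (P c)) → T (allCodes (λ c → ⌊ P? c ⌋)) → ∀ c → P c
allCodes-dec-sound P? all c = toWitness (allCodes-sound _ all c)

-- Relators act trivially on simple graphs

Constraints : ℕ → Set
Constraints k = List (Fin k × Fin k × Bool)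

Satisfies : Graph k → Fin k × Fin k × Bool → Set
Satisfies G (a , b , v) = G a b ≡ v

Holds : Graph k → Constraints k → Set
Holds G = All (Satisfies G)

holds? : (G : Graph k) (cs : Constraints k) → Dec (Holds G cs)
holds? G = all? λ (a , b , v) → G a b Bool.≟ v

Holds-cong : G ≈ H → ∀ {cs} → Holds G cs → Holds H cs
Holds-cong G≈H = All.map λ {(a , b , v)} Gab → trans (sym (G≈H a b)) Gab

Fixes : Word k → Constraints k → Set
Fixes {k} r cs = ∀ (R : Graph k) → IsSimple R → Holds R cs → R · r ≈ R

fixes? : (r : Word k) (cs : Constraints k) (t : Table k) → Dec (Holds (graphOf t) cs → t ·ᵀ r ≡ t)
fixes? r cs t = holds? (graphOf t) cs →-dec Vec.≡-dec (Vec.≡-dec Bool._≟_) (t ·ᵀ r) t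

FixesCheck : Word k → Constraints k → Set
FixesCheck r cs = T (allCodes (λ c → ⌊ fixes? r cs (tableFromCode c) ⌋))

Fixes-byEnumeration : ∀ (r : Word k) cs → FixesCheck r cs → Fixes r cs
Fixes-byEnumeration r cs all R simple holds =
  ≈-trans (·-cong R≈t r) (≈-trans (≈-sym (graphOf-·ᵀ t r)) (≈-trans t·r≈t (≈-sym R≈t)))
  where
  t = tableFromCode (codeOf R)
  R≈t = codeOf-correct simple
  t·r≡t : t ·ᵀ r ≡ t
  t·r≡t = allCodes-dec-sound (fixes? r cs ∘ tableFromCode) all (codeOf R) (Holds-cong R≈t holds)
  t·r≈t : graphOf (t ·ᵀ r) ≈ graphOf t
  t·r≈t x y = cong (λ t′ → graphOf t′ x y) t·r≡t

shift : Fin k × Fin k × Bool → Fin (suc k) × Fin (suc k) × Bool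
shift (a , b , v) = suc a , suc b , v

module _ {H : Graph n} (simple : IsSimple H) where

  private
    fixedOn : {vs : Vec (Fin n) k} → Unique vs → (r : Word k) {w : Word n} → map (lookup vs) r ≡ w →
      restrict H vs · r ≈ restrict H vs →
      ∀ i j → (H · w) (lookup vs i) (lookup vs j) ≡ H (lookup vs i) (lookup vs j)
    fixedOn distinct r refl fixes i j = trans (restrict-· distinct H r i j) (fixes i j)

    unique-∷ : {vs : Vec (Fin n) k} {y : Fin n} → ¬ (Σ (Fin k) λ i → lookup vs i ≡ y) →
      Unique vs → Unique (y ∷ vs)
    unique-∷ y∉vs distinct = VecAll.lookup⁻ (λ i y≡ → y∉vs (i , sym y≡)) ∷ distinct

  -- The three checks cover the cases where none, one or both of x y lie outside vs.
  Fixes-embed : (vs : Vec (Fin n) k) → Unique vs → (r : Word k) (cs : Constraints k) → Holds (restrict H vs) cs →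
    FixesCheck r cs → FixesCheck (map suc r) (map shift cs) →
    FixesCheck (map suc (map suc r)) (map shift (map shift cs)) →
    H · map (lookup vs) r ≈ H
  Fixes-embed vs distinct r cs holds check₀ check₁ check₂ x y with x ≟ y
  ... | yes refl = trans (proj₂ (·-simple simple (map (lookup vs) r)) x) (sym (proj₂ simple x))
  ... | no x≢y with any? (λ i → lookup vs i ≟ x) | any? (λ j → lookup vs j ≟ y)
  ... | yes (i , refl) | yes (j , refl) =
    fixedOn distinct r refl (Fixes-byEnumeration r cs check₀ _ (restrict-simple simple vs) holds) i j
  ... | yes (i , refl) | no y∉vs =
    fixedOn distinct₁ (map suc r) (sym (map-∘ r))
      (Fixes-byEnumeration (map suc r) (map shift cs) check₁ _ (restrict-simple simple (y ∷ vs)) (All.map⁺ holds))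
      (suc i) zero
    where distinct₁ = unique-∷ y∉vs distinct
  ... | no x∉vs | yes (j , refl) =
    fixedOn distinct₁ (map suc r) (sym (map-∘ r))
      (Fixes-byEnumeration (map suc r) (map shift cs) check₁ _ (restrict-simple simple (x ∷ vs)) (All.map⁺ holds))
      zero (suc j)
    where distinct₁ = unique-∷ x∉vs distinct
  ... | no x∉vs | no y∉vs =
    fixedOn distinct₂ (map suc (map suc r)) (trans (sym (map-∘ (map suc r))) (sym (map-∘ r)))
      (Fixes-byEnumeration (map suc (map suc r)) (map shift (map shift cs)) check₂ _
        (restrict-simple simple (y ∷ x ∷ vs)) (All.map⁺ (All.map⁺ holds)))
      (suc zero) zero
    where
    y∉x∷vs : ¬ (Σ _ λ i → lookup (x ∷ vs) i ≡ y)
    y∉x∷vs (zero , x≡y)   = x≢y x≡y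
    y∉x∷vs (suc i , vs≡y) = y∉vs (i , vs≡y)
    distinct₂ = unique-∷ y∉x∷vs (unique-∷ x∉vs distinct)

pattern #0 = zero
pattern #1 = suc zero
pattern #2 = suc (suc zero)
pattern #3 = suc (suc (suc zero))

relator-fixes : IsSimple H → ∀ {r} → Relator H r → H · r ≈ H
relator-fixes simple (r-uu u) =
  Fixes-embed simple (u ∷ []) ([] ∷ []) (#0 ∷ #0 ∷ []) [] [] tt tt tt
relator-fixes simple (r-uvuv u v u≢v uv) =
  Fixes-embed simple (u ∷ v ∷ []) ((u≢v ∷ []) ∷ [] ∷ []) (#0 ∷ #1 ∷ #0 ∷ #1 ∷ [])
    ((#0 , #1 , false) ∷ []) (uv ∷ []) tt tt tt
relator-fixes simple (r-uvuvuv u v uv) =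
  Fixes-embed simple (u ∷ v ∷ []) ((adjacent⇒≢ simple uv ∷ []) ∷ [] ∷ []) (#0 ∷ #1 ∷ #0 ∷ #1 ∷ #0 ∷ #1 ∷ [])
    ((#0 , #1 , true) ∷ []) (uv ∷ []) tt tt tt
relator-fixes simple (r-9 u v w uv vw uw) =
  Fixes-embed simple (u ∷ v ∷ w ∷ [])
    ((adjacent⇒≢ simple uv ∷ adjacent⇒≢ simple uw ∷ []) ∷ (adjacent⇒≢ simple vw ∷ []) ∷ [] ∷ [])
    (#0 ∷ #1 ∷ #0 ∷ #1 ∷ #2 ∷ #1 ∷ #0 ∷ #2 ∷ #0 ∷ [])
    ((#0 , #1 , true) ∷ (#1 , #2 , true) ∷ (#0 , #2 , true) ∷ []) (uv ∷ vw ∷ uw ∷ []) tt tt tt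

Step-preserves : IsSimple G → ∀ {s t} → Step G s t → G · s ≈ G · t
Step-preserves {G = G} simple (delete p r q rel)
  rewrite ·-++ G p (r ++ q) | ·-++ (G · p) r q | ·-++ G p q =
  ·-cong (relator-fixes (·-simple simple p) rel) q
Step-preserves {G = G} simple (insert p r q rel)
  rewrite ·-++ G p (r ++ q) | ·-++ (G · p) r q | ·-++ G p q =
  ·-cong (≈-sym (relator-fixes (·-simple simple p) rel)) q

Loc-preserves : IsSimple G → ∀ {s t} → Loc G s t → G · s ≈ G · t
Loc-preserves simple ε          = ≈-refl
Loc-preserves simple (st ◅ sts) = ≈-trans (Step-preserves simple st) (Loc-preserves simple sts)

Disjoint⇒≢ : {xs ys : Word n} → Disjoint xs ys → ∀ {x y} → x ∈ xs → y ∈ ys → ¬ x ≡ y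
Disjoint⇒≢ xs∩ys x∈xs y∈ys refl = xs∩ys (x∈xs , y∈ys)

Disjoint-concat⁺ : {xs : Word n} {yss : List (Word n)} → Disjoint xs (concat yss) → All (Disjoint xs) yss
Disjoint-concat⁺ xs∩ = All.tabulate λ ys∈ (z∈xs , z∈ys) → xs∩ (z∈xs , ∈-concat⁺′ z∈ys ys∈)

Disjoint-concat⁻ : {xs : Word n} {yss : List (Word n)} → All (Disjoint xs) yss → Disjoint xs (concat yss)
Disjoint-concat⁻ {yss = ys ∷ yss} (xs∩ys ∷ xs∩yss) (z∈xs , z∈) with ∈-++⁻ ys z∈
... | inj₁ z∈ys  = xs∩ys (z∈xs , z∈ys)
... | inj₂ z∈yss = Disjoint-concat⁻ xs∩yss (z∈xs , z∈yss)

AllPairs-Disjoint-++ : (xss : List (Word n)) {yss : List (Word n)} →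
  AllPairs Disjoint (xss ++ yss) → Disjoint (concat xss) (concat yss)
AllPairs-Disjoint-++ []         _              (() , _)
AllPairs-Disjoint-++ (xs ∷ xss) (xs∩ ∷ pairs) (z∈ , z∈yss) with ∈-++⁻ xs z∈
... | inj₁ z∈xs  = Disjoint-concat⁻ (All.++⁻ʳ xss xs∩) (z∈xs , z∈yss)
... | inj₂ z∈xss = AllPairs-Disjoint-++ xss pairs (z∈xss , z∈yss)

AllPairs-++⁻ʳ : {A : Set} {R : A → A → Set} (xs : List A) {ys : List A} → AllPairs R (xs ++ ys) → AllPairs R ys
AllPairs-++⁻ʳ []       pairs       = pairs
AllPairs-++⁻ʳ (x ∷ xs) (_ ∷ pairs) = AllPairs-++⁻ʳ xs pairs

drop⊆ : ∀ m (xs : Word n) → drop m xs ⊆ xs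
drop⊆ zero    xs       p = p
drop⊆ (suc m) []       p = p
drop⊆ (suc m) (x ∷ xs) p = there (drop⊆ m xs p)

drop2-++ : (xs ys : Word n) → drop 2 (xs ++ ys) ⊆ drop 2 xs ++ ys
drop2-++ []           ys = drop⊆ 2 ys
drop2-++ (x ∷ [])     ys = drop⊆ 1 ys
drop2-++ (x ∷ y ∷ xs) ys p = p

blocksWord : List (Block n) → Word n
blocksWord bs = concat (map blockWord bs)

blocksWord-++ : (bs cs : List (Block n)) → blocksWord (bs ++ cs) ≡ blocksWord bs ++ blocksWord cs
blocksWord-++ bs cs =
  trans (cong concat (map-++ blockWord bs cs)) (sym (concat-++ (map blockWord bs) (map blockWord cs)))

mapBlock : (Fin k → Fin n) → Block k → Block n
mapBlock f (single u)   = single (f u)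
mapBlock f (triple u v) = triple (f u) (f v)

blockWord-map : (f : Fin k → Fin n) (b : Block k) → blockWord (mapBlock f b) ≡ map f (blockWord b)
blockWord-map f (single u)   = refl
blockWord-map f (triple u v) = refl

blockWords-map : (f : Fin k → Fin n) (bs : List (Block k)) →
  map blockWord (map (mapBlock f) bs) ≡ map (map f) (map blockWord bs)
blockWords-map f []       = refl
blockWords-map f (b ∷ bs) = cong₂ _∷_ (blockWord-map f b) (blockWords-map f bs)

blocksWord-map : (f : Fin k → Fin n) (bs : List (Block k)) →
  blocksWord (map (mapBlock f) bs) ≡ map f (blocksWord bs)
blocksWord-map f []       = refl
blocksWord-map f (b ∷ bs) =
  trans (cong₂ _++_ (blockWord-map f b) (blocksWord-map f bs)) (sym (map-++ f (blockWord b) (blocksWord bs)))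

BlocksOK-cong : G ≈ H → ∀ bs → BlocksOK G bs → BlocksOK H bs
BlocksOK-cong G≈H []                 _                  = tt
BlocksOK-cong G≈H (single u ∷ bs)    ok                 = BlocksOK-cong (lc-cong G≈H u) bs ok
BlocksOK-cong G≈H (triple u v ∷ bs)  (u≢v , uv , ok)    =
  u≢v , trans (sym (G≈H u v)) uv , BlocksOK-cong (·-cong G≈H (u ∷ v ∷ u ∷ [])) bs ok

BlocksOK-++⁻ : (G : Graph n) (bs cs : List (Block n)) → BlocksOK G (bs ++ cs) →
  BlocksOK G bs × BlocksOK (G · blocksWord bs) cs
BlocksOK-++⁻ G []                 cs ok              = tt , ok
BlocksOK-++⁻ G (single u ∷ bs)    cs ok              = BlocksOK-++⁻ (lc G u) bs cs ok
BlocksOK-++⁻ G (triple u v ∷ bs)  cs (u≢v , uv , ok) =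
  let (ok₁ , ok₂) = BlocksOK-++⁻ (G · (u ∷ v ∷ u ∷ [])) bs cs ok in (u≢v , uv , ok₁) , ok₂

BlocksOK-++⁺ : (G : Graph n) (bs cs : List (Block n)) →
  BlocksOK G bs → BlocksOK (G · blocksWord bs) cs → BlocksOK G (bs ++ cs)
BlocksOK-++⁺ G []                 cs _                 ok₂ = ok₂
BlocksOK-++⁺ G (single u ∷ bs)    cs ok₁               ok₂ = BlocksOK-++⁺ (lc G u) bs cs ok₁ ok₂
BlocksOK-++⁺ G (triple u v ∷ bs)  cs (u≢v , uv , ok₁)  ok₂ =
  u≢v , uv , BlocksOK-++⁺ (G · (u ∷ v ∷ u ∷ [])) bs cs ok₁ ok₂

BlocksOK-∷ : (b : Block n) {bs cs : List (Block n)} → BlocksOK G (b ∷ bs) → BlocksOK (G · blockWord b) cs →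
  BlocksOK G (b ∷ cs)
BlocksOK-∷ (single u)   _                 valid = valid
BlocksOK-∷ (triple u v) (u≢v , uv , _)    valid = u≢v , uv , valid

module _ {vs : Vec (Fin n) k} (distinct : Unique vs) where

  private
    ι : Fin k → Fin n
    ι = lookup vs

    injective : ∀ {i j} → ι i ≡ ι j → i ≡ j
    injective = lookup-injective distinct _ _

  BlocksOK-embed : ∀ bs → BlocksOK (restrict G vs) bs → BlocksOK G (map (mapBlock ι) bs)
  BlocksOK-embed []                _               = tt
  BlocksOK-embed {G = G} (single u ∷ bs) ok =
    BlocksOK-embed bs (BlocksOK-cong (≈-sym (restrict-lc distinct G u)) bs ok)
  BlocksOK-embed {G = G} (triple u v ∷ bs) (u≢v , uv , ok) =
    u≢v ∘ injective , uv ,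
    BlocksOK-embed bs (BlocksOK-cong (≈-sym (restrict-· distinct G (u ∷ v ∷ u ∷ []))) bs ok)

  BlocksOK-restrict : ∀ bs → BlocksOK G (map (mapBlock ι) bs) → BlocksOK (restrict G vs) bs
  BlocksOK-restrict []                _               = tt
  BlocksOK-restrict {G = G} (single u ∷ bs) ok =
    BlocksOK-cong (restrict-lc distinct G u) bs (BlocksOK-restrict bs ok)
  BlocksOK-restrict {G = G} (triple u v ∷ bs) (u≢v , uv , ok) =
    u≢v ∘ cong ι , uv ,
    BlocksOK-cong (restrict-· distinct G (u ∷ v ∷ u ∷ [])) bs (BlocksOK-restrict bs ok)

  Disjoint-map : {xs ys : Word k} → Disjoint xs ys → Disjoint (map ι xs) (map ι ys)
  Disjoint-map xs∩ys (z∈ιxs , z∈ιys) with ∈-map⁻ ι z∈ιxs | ∈-map⁻ ι z∈ιys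
  ... | x , x∈xs , refl | y , y∈ys , ιx≡ιy = xs∩ys (x∈xs , subst (_∈ _) (sym (injective ιx≡ιy)) y∈ys)

  ∉-map : ∀ {u xs} → u ∉ xs → ι u ∉ map ι xs
  ∉-map u∉xs ιu∈ιxs with ∈-map⁻ ι ιu∈ιxs
  ... | x , x∈xs , ιu≡ιx = u∉xs (subst (_∈ _) (sym (injective ιu≡ιx)) x∈xs)

record Reduct (G : Graph n) (w : Word n) : Set where
  constructor reduct
  field
    blocks   : List (Block n)
    reaches  : Loc G w (blocksWord blocks)
    valid    : BlocksOK G blocks
    disjoint : AllPairs Disjoint (map blockWord blocks)
    letters  : blocksWord blocks ⊆ w

FrontReduct : Graph n → Word n → Fin n → Set
FrontReduct G w u = Σ (Reduct G w) λ ρ → u ∉ drop 2 (blocksWord (Reduct.blocks ρ))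

FrontReduct-cong : G ≈ H → ∀ {w u} → FrontReduct G w u → FrontReduct H w u
FrontReduct-cong G≈H (reduct bs reaches valid disjoint letters , u∉) =
  reduct bs (Loc-cong G≈H reaches) (BlocksOK-cong G≈H bs valid) disjoint letters , u∉

Reduct-precompose : Loc G w w′ → w′ ⊆ w → Reduct G w′ → Reduct G w
Reduct-precompose l w′⊆w (reduct bs reaches valid disjoint letters) =
  reduct bs (l ◅◅ reaches) valid disjoint (w′⊆w ∘ letters)

FrontReduct-precompose : ∀ {u} → Loc G w w′ → w′ ⊆ w → FrontReduct G w′ u → FrontReduct G w u
FrontReduct-precompose l w′⊆w (ρ , u∉) = Reduct-precompose l w′⊆w ρ , u∉

Reduct-refl : ∀ bs → BlocksOK G bs → AllPairs Disjoint (map blockWord bs) → Reduct G (blocksWord bs)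
Reduct-refl bs valid disjoint = reduct bs ε valid disjoint (λ z∈ → z∈)

module _ {vs : Vec (Fin n) k} (distinct : Unique vs) where

  private
    ι : Fin k → Fin n
    ι = lookup vs

  Reduct-embed : ∀ {w} → Reduct (restrict G vs) w → Reduct G (map ι w)
  Reduct-embed {G = G} {w} (reduct bs reaches valid disjoint letters) = record
    { blocks   = map (mapBlock ι) bs
    ; reaches  = subst (Loc G (map ι w)) (sym (blocksWord-map ι bs)) (Loc-embed distinct reaches)
    ; valid    = BlocksOK-embed distinct bs valid
    ; disjoint = subst (AllPairs Disjoint) (sym (blockWords-map ι bs))
                   (AllPairs.map⁺ (AllPairs.map (Disjoint-map distinct) disjoint))
    ; letters  = Subset.map⁺ ι letters ∘ subst (_ ∈_) (blocksWord-map ι bs)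
    }

  FrontReduct-embed : ∀ {w u} → FrontReduct (restrict G vs) w u → FrontReduct G (map ι w) (ι u)
  FrontReduct-embed (ρ , u∉) =
    Reduct-embed ρ ,
    ∉-map distinct u∉ ∘ subst (_ ∈_) (trans (cong (drop 2) (blocksWord-map ι bs)) (drop-map 2 (blocksWord bs)))
    where bs = Reduct.blocks ρ

module _ (simple : IsSimple G) where

  Reduct-++ : ∀ {w} (ρ : Reduct G w) rest → BlocksOK (G · w) rest →
    AllPairs Disjoint (map blockWord rest) → Disjoint w (blocksWord rest) → Reduct G (w ++ blocksWord rest)
  Reduct-++ {w} (reduct bs reaches valid disjoint letters) rest valid′ disjoint′ w∩rest = record
    { blocks   = bs ++ rest
    ; reaches  = subst (Loc G (w ++ blocksWord rest)) (sym (blocksWord-++ bs rest))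
                   (Loc-suffix (blocksWord rest) reaches)
    ; valid    = BlocksOK-++⁺ G bs rest valid
                   (BlocksOK-cong (Loc-preserves simple reaches) rest valid′)
    ; disjoint = subst (AllPairs Disjoint) (sym (map-++ blockWord bs rest))
                   (AllPairs.++⁺ disjoint disjoint′ (All.tabulate λ b∈ → Disjoint-concat⁺ λ (z∈b , z∈rest) →
                     w∩rest (letters (∈-concat⁺′ z∈b b∈) , z∈rest)))
    ; letters  = Subset.++⁺ˡ (blocksWord rest) letters ∘ subst (_ ∈_) (blocksWord-++ bs rest)
    }

  FrontReduct-++ : ∀ {w u} (ρ : FrontReduct G w u) rest → BlocksOK (G · w) rest →
    AllPairs Disjoint (map blockWord rest) → Disjoint w (blocksWord rest) → u ∈ w →
    FrontReduct G (w ++ blocksWord rest) u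
  FrontReduct-++ {u = u} (ρ , u∉) rest valid′ disjoint′ w∩rest u∈w =
    Reduct-++ ρ rest valid′ disjoint′ w∩rest , u∉drop2
    where
    bs = Reduct.blocks ρ
    u∉drop2 : u ∉ drop 2 (blocksWord (bs ++ rest))
    u∉drop2 u∈ with ∈-++⁻ (drop 2 (blocksWord bs)) (drop2-++ (blocksWord bs) (blocksWord rest)
                      (subst (λ z → _ ∈ drop 2 z) (blocksWord-++ bs rest) u∈))
    ... | inj₁ u∈bs   = u∉ u∈bs
    ... | inj₂ u∈rest = w∩rest (u∈w , u∈rest)

-- Checking certificates of rewriting on few vertices

data RelatorCode (k : ℕ) : Set where
  uu          : Fin k → RelatorCode k
  uvuv uvuvuv : Fin k → Fin k → RelatorCode k
  uvuvwvuwu   : Fin k → Fin k → Fin k → RelatorCode k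

relatorWord : RelatorCode k → Word k
relatorWord (uu u)            = u ∷ u ∷ []
relatorWord (uvuv u v)        = u ∷ v ∷ u ∷ v ∷ []
relatorWord (uvuvuv u v)      = u ∷ v ∷ u ∷ v ∷ u ∷ v ∷ []
relatorWord (uvuvwvuwu u v w) = u ∷ v ∷ u ∷ v ∷ w ∷ v ∷ u ∷ w ∷ u ∷ []

relator? : (H : Graph k) (c : RelatorCode k) → Maybe (Relator H (relatorWord c))
relator? H (uu u) = just (r-uu u)
relator? H (uvuv u v) with u ≟ v | H u v in uv
... | no u≢v | false = just (r-uvuv u v u≢v uv)
... | _      | _     = nothing
relator? H (uvuvuv u v) with H u v in uv
... | true  = just (r-uvuvuv u v uv)
... | false = nothing
relator? H (uvuvwvuwu u v w) with H u v in uv | H v w in vw | H u w in uw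
... | true | true | true = just (r-9 u v w uv vw uw)
... | _    | _    | _    = nothing

-- At position i of the current word, the factor formed by the first s letters of a relator
-- (byPrefix) or by the relator without its first s letters (bySuffix) is replaced by the
-- reverse of the remaining letters.
data Move (k : ℕ) : Set where
  byPrefix bySuffix : ℕ → RelatorCode k → ℕ → Move k

splitPrefix : (x w : Word k) → Maybe (Σ (Word k) λ q → w ≡ x ++ q)
splitPrefix []      w       = just (w , refl)
splitPrefix (a ∷ x) []      = nothing
splitPrefix (a ∷ x) (b ∷ w) with a ≟ b | splitPrefix x w
... | yes refl | just (q , w≡xq) = just (q , cong (a ∷_) w≡xq)
... | _        | _               = nothing

Relator-fromTable : (t : Table k) (p : Word k) {r r′ : Word k} → r ≡ r′ →
  Relator (graphOf (t ·ᵀ p)) r → Relator (graphOf t · p) r′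
Relator-fromTable t p refl = Relator-cong (graphOf-·ᵀ t p)

runMove : (t : Table k) (w : Word k) → Move k → Maybe (Σ (Word k) (Loc (graphOf t) w))
runMove t w (byPrefix i c s) with splitPrefix (take s (relatorWord c)) (drop i w)
... | nothing = nothing
... | just (q , w≡) with relator? (graphOf (t ·ᵀ take i w)) c
...   | nothing  = nothing
...   | just rel = just (take i w ++ reverse (drop s (relatorWord c)) ++ q ,
          subst₂ (Loc (graphOf t)) (trans (cong (take i w ++_) (sym w≡)) (take++drop≡id i w)) refl
            (Loc-replaceRelatorPrefix (graphOf t) (take i w) (take s (relatorWord c)) (drop s (relatorWord c)) q
              (Relator-fromTable t (take i w) (sym (take++drop≡id s (relatorWord c))) rel)))
runMove t w (bySuffix i c s) with splitPrefix (drop s (relatorWord c)) (drop i w)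
... | nothing = nothing
... | just (q , w≡) with relator? (graphOf (t ·ᵀ (take i w ++ reverse (take s (relatorWord c))))) c
...   | nothing  = nothing
...   | just rel = just (take i w ++ reverse (take s (relatorWord c)) ++ q ,
          subst₂ (Loc (graphOf t)) (trans (cong (take i w ++_) (sym w≡)) (take++drop≡id i w)) refl
            (Loc-replaceRelatorSuffix (graphOf t) (take i w) (drop s (relatorWord c)) (take s (relatorWord c)) q
              (Relator-fromTable t (take i w ++ reverse (take s (relatorWord c)))
                (sym (take++drop≡id s (relatorWord c))) rel)))

runMoves : (t : Table k) (w : Word k) → List (Move k) → Maybe (Σ (Word k) (Loc (graphOf t) w))
runMoves t w []           = just (w , ε)
runMoves t w (m ∷ moves) with runMove t w m
... | nothing        = nothing
... | just (w₁ , l₁) with runMoves t w₁ moves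
...   | nothing        = nothing
...   | just (w₂ , l₂) = just (w₂ , l₁ ◅◅ l₂)

blocksOK? : (t : Table k) (bs : List (Block k)) → Dec (BlocksOK (graphOf t) bs)
blocksOK? t [] = yes tt
blocksOK? t (single u ∷ bs) =
  map′ (BlocksOK-cong (graphOf-tableOf _) bs) (BlocksOK-cong (≈-sym (graphOf-tableOf _)) bs)
    (blocksOK? (lcᵀ t u) bs)
blocksOK? t (triple u v ∷ bs) =
  ¬? (u ≟ v) ×-dec graphOf t u v Bool.≟ true ×-dec
  map′ (BlocksOK-cong (graphOf-·ᵀ t (u ∷ v ∷ u ∷ [])) bs)
       (BlocksOK-cong (≈-sym (graphOf-·ᵀ t (u ∷ v ∷ u ∷ []))) bs)
    (blocksOK? (t ·ᵀ (u ∷ v ∷ u ∷ [])) bs)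

disjoint? : (xs ys : Word k) → Dec (Disjoint xs ys)
disjoint? xs ys =
  map′ (λ xs∉ys (z∈xs , z∈ys) → All.lookup xs∉ys z∈xs z∈ys)
       (λ xs∩ys → All.tabulate (λ z∈xs z∈ys → xs∩ys (z∈xs , z∈ys)))
    (all? (λ x → ¬? (DecMembership._∈?_ _≟_ x ys)) xs)

Certificate : ℕ → Set
Certificate k = List (Move k) × List (Block k)

verify : (t : Table k) (w : Word k) (u : Fin k) → Certificate k → Maybe (FrontReduct (graphOf t) w u)
verify t w u (moves , bs) with runMoves t w moves
... | nothing        = nothing
... | just (w′ , l) with ≡-dec _≟_ w′ (blocksWord bs)
...   | no _     = nothing
...   | yes refl with blocksOK? t bs | allPairs? disjoint? (map blockWord bs)
                    | DecSubset._⊆?_ _≟_ (blocksWord bs) w | ¬? (DecMembership._∈?_ _≟_ u (drop 2 (blocksWord bs)))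
...     | yes ok | yes dj | yes sub | yes u∉ = just (reduct bs l ok dj sub , u∉)
...     | _      | _      | _       | _      = nothing

record FrontReducible (pre : Word k) (pb : List (Block k)) (u : Fin k) : Set where
  constructor frontReducible
  field
    frontReduce : ∀ (R : Graph k) → IsSimple R → BlocksOK (R · pre) pb →
                  FrontReduct R (pre ++ blocksWord pb) u

-- Certificates are listed by the bits of the code of the graph; graphs in which the blocks
-- are not valid need none.
certificateFor : List Bool → List (List Bool × Certificate k) → Certificate k
certificateFor bits []                     = [] , []
certificateFor bits ((bits′ , cert) ∷ certs) with ≡-dec Bool._≟_ bits bits′
... | yes _ = cert
... | no _  = certificateFor bits certs

certified? : (pre : Word k) (pb : List (Block k)) (u : Fin k) (certs : List (List Bool × Certificate k))
  (c : Code k) →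
  Dec (BlocksOK (graphOf (tableFromCode c ·ᵀ pre)) pb →
       T (is-just (verify (tableFromCode c) (pre ++ blocksWord pb) u (certificateFor (codeBits c) certs))))
certified? pre pb u certs c = blocksOK? (tableFromCode c ·ᵀ pre) pb →-dec T? _

FrontReducible-byCertificates : (pre : Word k) (pb : List (Block k)) (u : Fin k)
  (certs : List (List Bool × Certificate k)) → T (allCodes (λ c → ⌊ certified? pre pb u certs c ⌋)) →
  FrontReducible pre pb u
FrontReducible-byCertificates pre pb u certs all = frontReducible reduce
  where
  reduce : ∀ R → IsSimple R → BlocksOK (R · pre) pb → FrontReduct R (pre ++ blocksWord pb) u
  reduce R simple valid =
    FrontReduct-cong (≈-sym R≈t)
      (to-witness-T _ (allCodes-dec-sound (certified? pre pb u certs) all (codeOf R) valid′))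
    where
    R≈t = codeOf-correct simple
    valid′ = BlocksOK-cong (≈-trans (·-cong R≈t pre) (≈-sym (graphOf-·ᵀ _ pre))) pb valid

-- Certified local rewritings. A name spells the word pre · pb with blocks separated by ·;
-- in front-…, the letter u is the vertex brought to the front.

reducible-x·x : FrontReducible {k = 1} (#0 ∷ []) (single #0 ∷ []) #0
reducible-x·x = FrontReducible-byCertificates (#0 ∷ []) (single #0 ∷ []) #0 certificates tt
  where
  certificates : List (List Bool × Certificate 1)
  certificates =
      ([] , (bySuffix 0 (uu #0) 0 ∷ []) , [])
    ∷ []

reducible-x·dxd : FrontReducible {k = 2} (#0 ∷ []) (triple #1 #0 ∷ []) #1
reducible-x·dxd = FrontReducible-byCertificates (#0 ∷ []) (triple #1 #0 ∷ []) #1 certificates tt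
  where
  certificates : List (List Bool × Certificate 2)
  certificates =
      (true ∷ [] , (bySuffix 0 (uvuvuv #0 #1) 2 ∷ []) , (single #1 ∷ single #0 ∷ []))
    ∷ []

reducible-x·d·x : FrontReducible {k = 2} (#0 ∷ []) (single #1 ∷ single #0 ∷ []) #1
reducible-x·d·x = FrontReducible-byCertificates (#0 ∷ []) (single #1 ∷ single #0 ∷ []) #1 certificates tt
  where
  certificates : List (List Bool × Certificate 2)
  certificates =
      (false ∷ [] , (byPrefix 0 (uvuv #0 #1) 3 ∷ []) , (single #1 ∷ []))
    ∷ (true ∷ [] , [] , (triple #0 #1 ∷ []))
    ∷ []

front-udu : FrontReducible {k = 2} [] (triple #0 #1 ∷ []) #0
front-udu = FrontReducible-byCertificates [] (triple #0 #1 ∷ []) #0 certificates tt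
  where
  certificates : List (List Bool × Certificate 2)
  certificates =
      (true ∷ [] , (byPrefix 0 (uvuvuv #0 #1) 3 ∷ []) , (triple #1 #0 ∷ []))
    ∷ []

front-a·u : FrontReducible {k = 2} [] (single #0 ∷ single #1 ∷ []) #1
front-a·u = FrontReducible-byCertificates [] (single #0 ∷ single #1 ∷ []) #1 certificates tt
  where
  certificates : List (List Bool × Certificate 2)
  certificates =
      (false ∷ [] , [] , (single #0 ∷ single #1 ∷ []))
    ∷ (true ∷ [] , [] , (single #0 ∷ single #1 ∷ []))
    ∷ []

front-a·dud : FrontReducible {k = 3} [] (single #0 ∷ triple #1 #2 ∷ []) #2
front-a·dud = FrontReducible-byCertificates [] (single #0 ∷ triple #1 #2 ∷ []) #2 certificates tt
  where
  certificates : List (List Bool × Certificate 3)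
  certificates =
      (false ∷ false ∷ true ∷ [] , (bySuffix 0 (uvuv #0 #1) 2 ∷ bySuffix 1 (uvuv #0 #2) 2 ∷ bySuffix 2 (uvuv #0 #1) 2 ∷ []) , (triple #1 #2 ∷ single #0 ∷ []))
    ∷ (false ∷ true ∷ true ∷ [] , (bySuffix 0 (uvuv #0 #1) 2 ∷ byPrefix 0 (uvuvuv #1 #2) 1 ∷ byPrefix 1 (uvuvwvuwu #1 #2 #0) 7 ∷ []) , (single #2 ∷ single #1 ∷ single #0 ∷ []))
    ∷ (true ∷ false ∷ true ∷ [] , (bySuffix 0 (uvuvwvuwu #1 #2 #0) 7 ∷ bySuffix 3 (uvuvuv #2 #1) 0 ∷ []) , (single #1 ∷ single #2 ∷ single #0 ∷ []))
    ∷ (true ∷ true ∷ false ∷ [] , (bySuffix 0 (uvuvwvuwu #1 #0 #2) 5 ∷ bySuffix 1 (uvuvuv #0 #1) 2 ∷ []) , (single #2 ∷ single #1 ∷ single #0 ∷ []))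
    ∷ []

front-a·d·u : FrontReducible {k = 3} [] (single #0 ∷ single #1 ∷ single #2 ∷ []) #2
front-a·d·u = FrontReducible-byCertificates [] (single #0 ∷ single #1 ∷ single #2 ∷ []) #2 certificates tt
  where
  certificates : List (List Bool × Certificate 3)
  certificates =
      (false ∷ false ∷ false ∷ [] , (bySuffix 1 (uvuv #1 #2) 2 ∷ []) , (single #0 ∷ single #2 ∷ single #1 ∷ []))
    ∷ (false ∷ false ∷ true ∷ [] , (bySuffix 0 (uvuv #0 #1) 2 ∷ bySuffix 1 (uvuv #0 #2) 2 ∷ []) , (single #1 ∷ single #2 ∷ single #0 ∷ []))
    ∷ (false ∷ true ∷ false ∷ [] , (bySuffix 1 (uvuv #1 #2) 2 ∷ []) , (single #0 ∷ single #2 ∷ single #1 ∷ []))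
    ∷ (false ∷ true ∷ true ∷ [] , (byPrefix 0 (uvuvuv #0 #2) 1 ∷ byPrefix 1 (uvuvwvuwu #0 #2 #1) 6 ∷ []) , (single #2 ∷ triple #0 #1 ∷ []))
    ∷ (true ∷ false ∷ false ∷ [] , (bySuffix 1 (uvuv #1 #2) 2 ∷ []) , (single #0 ∷ single #2 ∷ single #1 ∷ []))
    ∷ (true ∷ false ∷ true ∷ [] , (bySuffix 0 (uvuvuv #0 #1) 4 ∷ bySuffix 1 (uvuvwvuwu #0 #2 #1) 6 ∷ bySuffix 3 (uvuvuv #0 #2) 1 ∷ []) , (triple #1 #2 ∷ single #0 ∷ []))
    ∷ (true ∷ true ∷ false ∷ [] , (bySuffix 1 (uvuvuv #1 #2) 4 ∷ byPrefix 1 (uvuvwvuwu #2 #1 #0) 4 ∷ bySuffix 0 (uvuvuv #0 #2) 2 ∷ []) , (single #2 ∷ triple #0 #1 ∷ []))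
    ∷ (true ∷ true ∷ true ∷ [] , (bySuffix 1 (uvuv #1 #2) 2 ∷ []) , (single #0 ∷ single #2 ∷ single #1 ∷ []))
    ∷ []

front-aca·u : FrontReducible {k = 3} [] (triple #0 #1 ∷ single #2 ∷ []) #2
front-aca·u = FrontReducible-byCertificates [] (triple #0 #1 ∷ single #2 ∷ []) #2 certificates tt
  where
  certificates : List (List Bool × Certificate 3)
  certificates =
      (true ∷ false ∷ false ∷ [] , (byPrefix 0 (uvuv #0 #2) 1 ∷ bySuffix 2 (uvuv #2 #1) 2 ∷ bySuffix 3 (uvuv #0 #2) 1 ∷ []) , (single #2 ∷ triple #0 #1 ∷ []))
    ∷ (true ∷ false ∷ true ∷ [] , (bySuffix 0 (uu #1) 2 ∷ byPrefix 1 (uvuvwvuwu #1 #0 #2) 5 ∷ bySuffix 0 (uu #1) 0 ∷ []) , (single #2 ∷ single #1 ∷ single #0 ∷ []))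
    ∷ (true ∷ true ∷ false ∷ [] , (bySuffix 1 (uvuvuv #1 #0) 4 ∷ byPrefix 1 (uvuvwvuwu #0 #1 #2) 5 ∷ bySuffix 0 (uu #0) 0 ∷ []) , (single #2 ∷ single #0 ∷ single #1 ∷ []))
    ∷ (true ∷ true ∷ true ∷ [] , (bySuffix 0 (uvuvwvuwu #0 #2 #1) 6 ∷ bySuffix 2 (uvuvuv #0 #2) 1 ∷ []) , (single #2 ∷ single #1 ∷ single #0 ∷ []))
    ∷ []

front-aca·dud : FrontReducible {k = 4} [] (triple #0 #1 ∷ triple #2 #3 ∷ []) #3
front-aca·dud = FrontReducible-byCertificates [] (triple #0 #1 ∷ triple #2 #3 ∷ []) #3 certificates tt
  where
  certificates : List (List Bool × Certificate 4)
  certificates =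
      (true ∷ false ∷ false ∷ false ∷ false ∷ true ∷ [] , (byPrefix 0 (uvuv #0 #2) 1 ∷ bySuffix 2 (uvuv #2 #1) 2 ∷ bySuffix 3 (uvuv #0 #2) 1 ∷ byPrefix 1 (uvuv #0 #3) 1 ∷ bySuffix 3 (uvuv #3 #1) 2 ∷ bySuffix 4 (uvuv #0 #3) 1 ∷ byPrefix 2 (uvuv #0 #2) 1 ∷ bySuffix 4 (uvuv #2 #1) 2 ∷ bySuffix 5 (uvuv #0 #2) 1 ∷ []) , (triple #2 #3 ∷ triple #0 #1 ∷ []))
    ∷ (true ∷ false ∷ false ∷ false ∷ true ∷ true ∷ [] , (bySuffix 0 (uu #1) 2 ∷ byPrefix 1 (uvuvwvuwu #1 #0 #3) 4 ∷ bySuffix 0 (uu #1) 0 ∷ byPrefix 3 (uvuvwvuwu #3 #2 #0) 4 ∷ bySuffix 2 (uvuvuv #0 #3) 2 ∷ bySuffix 0 (uvuvuv #1 #3) 3 ∷ []) , (triple #1 #3 ∷ triple #0 #2 ∷ []))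
    ∷ (true ∷ false ∷ false ∷ true ∷ false ∷ true ∷ [] , (bySuffix 0 (uu #1) 2 ∷ byPrefix 1 (uvuvwvuwu #1 #0 #2) 5 ∷ bySuffix 0 (uu #1) 0 ∷ bySuffix 4 (uvuv #0 #2) 3 ∷ bySuffix 1 (uvuvwvuwu #0 #1 #3) 5 ∷ bySuffix 2 (uvuvuv #1 #0) 2 ∷ byPrefix 2 (uvuv #0 #2) 1 ∷ bySuffix 4 (uvuv #1 #2) 1 ∷ []) , (triple #2 #3 ∷ triple #0 #1 ∷ []))
    ∷ (true ∷ false ∷ false ∷ true ∷ true ∷ true ∷ [] , (bySuffix 2 (uvuvuv #0 #2) 4 ∷ bySuffix 0 (uvuvwvuwu #2 #1 #0) 4 ∷ byPrefix 0 (uvuvwvuwu #1 #2 #3) 4 ∷ bySuffix 4 (uvuv #0 #3) 1 ∷ []) , (triple #1 #3 ∷ triple #2 #0 ∷ []))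
    ∷ (true ∷ false ∷ true ∷ false ∷ false ∷ true ∷ [] , (bySuffix 1 (uvuvuv #1 #0) 4 ∷ byPrefix 1 (uvuvwvuwu #0 #1 #3) 4 ∷ bySuffix 0 (uu #0) 0 ∷ byPrefix 3 (uvuvwvuwu #3 #2 #1) 4 ∷ bySuffix 2 (uvuvuv #1 #3) 2 ∷ bySuffix 0 (uvuvuv #0 #3) 3 ∷ []) , (triple #0 #3 ∷ triple #1 #2 ∷ []))
    ∷ (true ∷ false ∷ true ∷ false ∷ true ∷ true ∷ [] , (bySuffix 3 (uu #3) 2 ∷ byPrefix 4 (uvuvwvuwu #3 #2 #1) 4 ∷ bySuffix 3 (uu #3) 0 ∷ byPrefix 0 (uvuvwvuwu #0 #1 #3) 5 ∷ []) , (triple #0 #3 ∷ triple #1 #2 ∷ []))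
    ∷ (true ∷ false ∷ true ∷ true ∷ false ∷ false ∷ [] , (bySuffix 1 (uvuvuv #1 #0) 4 ∷ byPrefix 1 (uvuvwvuwu #0 #1 #3) 4 ∷ bySuffix 0 (uu #0) 0 ∷ byPrefix 3 (uvuvwvuwu #3 #2 #1) 4 ∷ bySuffix 2 (uvuvuv #1 #3) 2 ∷ bySuffix 0 (uvuvuv #0 #3) 3 ∷ []) , (triple #0 #3 ∷ triple #1 #2 ∷ []))
    ∷ (true ∷ false ∷ true ∷ true ∷ true ∷ false ∷ [] , (bySuffix 0 (uvuvuv #0 #1) 4 ∷ byPrefix 0 (uvuvwvuwu #1 #0 #3) 4 ∷ bySuffix 3 (uvuvwvuwu #2 #0 #3) 3 ∷ []) , (triple #1 #3 ∷ triple #2 #0 ∷ []))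
    ∷ (true ∷ true ∷ false ∷ false ∷ false ∷ true ∷ [] , (bySuffix 1 (uvuvuv #1 #0) 4 ∷ byPrefix 1 (uvuvwvuwu #0 #1 #2) 5 ∷ bySuffix 0 (uu #0) 0 ∷ bySuffix 4 (uvuv #1 #2) 3 ∷ bySuffix 1 (uvuvwvuwu #1 #0 #3) 5 ∷ bySuffix 2 (uvuvuv #0 #1) 2 ∷ byPrefix 2 (uvuv #1 #2) 1 ∷ bySuffix 4 (uvuv #0 #2) 1 ∷ []) , (triple #2 #3 ∷ triple #1 #0 ∷ []))
    ∷ (true ∷ true ∷ false ∷ false ∷ true ∷ false ∷ [] , (bySuffix 0 (uu #1) 2 ∷ byPrefix 1 (uvuvwvuwu #1 #0 #3) 4 ∷ bySuffix 0 (uu #1) 0 ∷ byPrefix 3 (uvuvwvuwu #3 #2 #0) 4 ∷ bySuffix 2 (uvuvuv #0 #3) 2 ∷ bySuffix 0 (uvuvuv #1 #3) 3 ∷ []) , (triple #1 #3 ∷ triple #0 #2 ∷ []))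
    ∷ (true ∷ true ∷ false ∷ true ∷ false ∷ true ∷ [] , (bySuffix 0 (uvuvwvuwu #0 #2 #1) 6 ∷ bySuffix 2 (uvuvuv #0 #2) 1 ∷ byPrefix 1 (uvuvuv #1 #3) 1 ∷ byPrefix 2 (uvuvwvuwu #1 #3 #0) 6 ∷ byPrefix 2 (uvuv #1 #2) 1 ∷ bySuffix 4 (uvuv #2 #0) 2 ∷ bySuffix 5 (uvuv #1 #2) 1 ∷ []) , (triple #2 #3 ∷ triple #1 #0 ∷ []))
    ∷ (true ∷ true ∷ false ∷ true ∷ true ∷ false ∷ [] , (bySuffix 2 (uvuvwvuwu #2 #0 #3) 5 ∷ bySuffix 4 (uu #3) 2 ∷ bySuffix 0 (uvuvwvuwu #3 #1 #0) 4 ∷ bySuffix 3 (uu #3) 0 ∷ []) , (triple #1 #3 ∷ triple #2 #0 ∷ []))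
    ∷ (true ∷ true ∷ true ∷ false ∷ false ∷ true ∷ [] , (byPrefix 0 (uvuvuv #0 #1) 3 ∷ bySuffix 2 (uvuvuv #1 #2) 4 ∷ bySuffix 0 (uvuvwvuwu #2 #0 #1) 4 ∷ byPrefix 0 (uvuvwvuwu #0 #2 #3) 4 ∷ bySuffix 4 (uvuv #1 #3) 1 ∷ []) , (triple #0 #3 ∷ triple #2 #1 ∷ []))
    ∷ (true ∷ true ∷ true ∷ false ∷ true ∷ false ∷ [] , (byPrefix 0 (uvuvwvuwu #0 #1 #3) 3 ∷ bySuffix 3 (uvuvwvuwu #2 #1 #3) 3 ∷ []) , (triple #0 #3 ∷ triple #2 #1 ∷ []))
    ∷ (true ∷ true ∷ true ∷ true ∷ false ∷ false ∷ [] , (byPrefix 0 (uvuvuv #0 #1) 3 ∷ bySuffix 2 (uvuvwvuwu #2 #1 #3) 5 ∷ bySuffix 4 (uu #3) 2 ∷ bySuffix 0 (uvuvwvuwu #3 #0 #1) 4 ∷ bySuffix 3 (uu #3) 0 ∷ []) , (triple #0 #3 ∷ triple #2 #1 ∷ []))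
    ∷ (true ∷ true ∷ true ∷ true ∷ true ∷ true ∷ [] , (byPrefix 0 (uvuvwvuwu #0 #1 #3) 3 ∷ bySuffix 3 (uvuvwvuwu #2 #1 #3) 3 ∷ []) , (triple #0 #3 ∷ triple #2 #1 ∷ []))
    ∷ []

front-aca·d·u : FrontReducible {k = 4} [] (triple #0 #1 ∷ single #2 ∷ single #3 ∷ []) #3
front-aca·d·u = FrontReducible-byCertificates [] (triple #0 #1 ∷ single #2 ∷ single #3 ∷ []) #3 certificates tt
  where
  certificates : List (List Bool × Certificate 4)
  certificates =
      (true ∷ false ∷ false ∷ false ∷ false ∷ false ∷ [] , (byPrefix 0 (uvuv #0 #3) 1 ∷ bySuffix 2 (uvuv #3 #1) 2 ∷ bySuffix 3 (uvuv #3 #0) 2 ∷ bySuffix 4 (uvuv #2 #3) 1 ∷ []) , (single #3 ∷ triple #0 #1 ∷ single #2 ∷ []))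
    ∷ (true ∷ false ∷ false ∷ false ∷ false ∷ true ∷ [] , (byPrefix 0 (uvuv #0 #2) 1 ∷ byPrefix 1 (uvuv #0 #3) 1 ∷ bySuffix 4 (uvuv #2 #1) 2 ∷ bySuffix 3 (uvuv #3 #1) 2 ∷ bySuffix 5 (uvuv #0 #2) 1 ∷ bySuffix 4 (uvuv #0 #3) 1 ∷ []) , (single #2 ∷ single #3 ∷ triple #0 #1 ∷ []))
    ∷ (true ∷ false ∷ false ∷ false ∷ true ∷ false ∷ [] , (bySuffix 0 (uu #1) 2 ∷ byPrefix 1 (uvuvwvuwu #1 #0 #3) 4 ∷ bySuffix 0 (uu #1) 0 ∷ bySuffix 3 (uvuv #2 #3) 1 ∷ []) , (single #3 ∷ single #1 ∷ single #0 ∷ single #2 ∷ []))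
    ∷ (true ∷ false ∷ false ∷ false ∷ true ∷ true ∷ [] , (byPrefix 2 (uvuvuv #0 #3) 1 ∷ bySuffix 0 (uvuvwvuwu #3 #1 #0) 4 ∷ bySuffix 4 (uvuvwvuwu #3 #0 #2) 5 ∷ bySuffix 3 (uvuv #3 #2) 2 ∷ bySuffix 4 (uvuvuv #0 #3) 1 ∷ []) , (triple #1 #3 ∷ single #2 ∷ single #0 ∷ []))
    ∷ (true ∷ false ∷ false ∷ true ∷ false ∷ false ∷ [] , (byPrefix 0 (uvuv #0 #3) 1 ∷ bySuffix 2 (uvuv #3 #1) 2 ∷ bySuffix 3 (uvuv #3 #0) 2 ∷ bySuffix 4 (uvuv #2 #3) 1 ∷ []) , (single #3 ∷ triple #0 #1 ∷ single #2 ∷ []))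
    ∷ (true ∷ false ∷ false ∷ true ∷ false ∷ true ∷ [] , (bySuffix 0 (uu #1) 2 ∷ byPrefix 1 (uvuvwvuwu #1 #0 #2) 5 ∷ bySuffix 0 (uu #1) 0 ∷ bySuffix 2 (uvuvuv #0 #3) 4 ∷ byPrefix 2 (uvuvwvuwu #3 #0 #1) 4 ∷ bySuffix 1 (uvuvuv #1 #3) 2 ∷ []) , (single #2 ∷ single #3 ∷ triple #1 #0 ∷ []))
    ∷ (true ∷ false ∷ false ∷ true ∷ true ∷ false ∷ [] , (bySuffix 0 (uu #1) 2 ∷ byPrefix 1 (uvuvwvuwu #1 #0 #3) 4 ∷ bySuffix 0 (uu #1) 0 ∷ bySuffix 3 (uvuv #2 #3) 1 ∷ []) , (single #3 ∷ single #1 ∷ single #0 ∷ single #2 ∷ []))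
    ∷ (true ∷ false ∷ false ∷ true ∷ true ∷ true ∷ [] , (bySuffix 2 (uvuvuv #0 #2) 4 ∷ bySuffix 0 (uvuvwvuwu #2 #1 #0) 4 ∷ byPrefix 0 (uvuvwvuwu #1 #2 #3) 4 ∷ bySuffix 4 (uvuv #0 #3) 1 ∷ []) , (triple #1 #3 ∷ single #2 ∷ single #0 ∷ []))
    ∷ (true ∷ false ∷ true ∷ false ∷ false ∷ false ∷ [] , (bySuffix 1 (uvuvuv #1 #0) 4 ∷ byPrefix 1 (uvuvwvuwu #0 #1 #3) 4 ∷ bySuffix 0 (uu #0) 0 ∷ bySuffix 3 (uvuv #2 #3) 1 ∷ []) , (single #3 ∷ single #0 ∷ single #1 ∷ single #2 ∷ []))
    ∷ (true ∷ false ∷ true ∷ false ∷ false ∷ true ∷ [] , (byPrefix 1 (uvuv #1 #2) 1 ∷ bySuffix 3 (uvuv #0 #2) 1 ∷ bySuffix 2 (uvuvuv #1 #0) 4 ∷ byPrefix 2 (uvuvwvuwu #0 #1 #3) 5 ∷ byPrefix 0 (uvuv #0 #2) 3 ∷ []) , (single #2 ∷ single #3 ∷ single #0 ∷ single #1 ∷ []))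
    ∷ (true ∷ false ∷ true ∷ false ∷ true ∷ false ∷ [] , (bySuffix 0 (uvuvwvuwu #0 #3 #1) 6 ∷ bySuffix 2 (uvuvuv #3 #0) 2 ∷ bySuffix 3 (uvuv #2 #3) 1 ∷ []) , (single #3 ∷ single #1 ∷ single #0 ∷ single #2 ∷ []))
    ∷ (true ∷ false ∷ true ∷ false ∷ true ∷ true ∷ [] , (byPrefix 2 (uvuvuv #0 #3) 1 ∷ byPrefix 3 (uvuvwvuwu #0 #3 #2) 6 ∷ bySuffix 0 (uvuvuv #0 #1) 4 ∷ byPrefix 0 (uvuvwvuwu #1 #0 #3) 6 ∷ []) , (triple #1 #3 ∷ single #2 ∷ single #0 ∷ []))
    ∷ (true ∷ false ∷ true ∷ true ∷ false ∷ false ∷ [] , (byPrefix 0 (uvuvuv #0 #1) 3 ∷ byPrefix 2 (uvuvuv #1 #3) 1 ∷ bySuffix 0 (uvuvwvuwu #3 #0 #1) 4 ∷ bySuffix 4 (uvuvwvuwu #3 #1 #2) 5 ∷ bySuffix 3 (uvuv #3 #2) 2 ∷ bySuffix 4 (uvuvuv #1 #3) 1 ∷ []) , (triple #0 #3 ∷ single #2 ∷ single #1 ∷ []))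
    ∷ (true ∷ false ∷ true ∷ true ∷ false ∷ true ∷ [] , (bySuffix 1 (uvuvuv #1 #0) 4 ∷ byPrefix 1 (uvuvwvuwu #0 #1 #3) 4 ∷ bySuffix 0 (uu #0) 0 ∷ bySuffix 3 (uvuv #2 #3) 1 ∷ []) , (single #3 ∷ single #0 ∷ single #1 ∷ single #2 ∷ []))
    ∷ (true ∷ false ∷ true ∷ true ∷ true ∷ false ∷ [] , (bySuffix 0 (uvuvuv #0 #1) 4 ∷ bySuffix 4 (uvuvuv #0 #2) 4 ∷ bySuffix 7 (uvuv #0 #3) 2 ∷ byPrefix 3 (uvuvwvuwu #0 #2 #3) 5 ∷ byPrefix 0 (uvuvwvuwu #1 #0 #3) 6 ∷ []) , (triple #1 #3 ∷ single #2 ∷ single #0 ∷ []))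
    ∷ (true ∷ false ∷ true ∷ true ∷ true ∷ true ∷ [] , (bySuffix 0 (uvuvwvuwu #0 #3 #1) 6 ∷ bySuffix 2 (uvuvuv #3 #0) 2 ∷ bySuffix 3 (uvuv #2 #3) 1 ∷ []) , (single #3 ∷ single #1 ∷ single #0 ∷ single #2 ∷ []))
    ∷ (true ∷ true ∷ false ∷ false ∷ false ∷ false ∷ [] , (byPrefix 0 (uvuv #0 #3) 1 ∷ bySuffix 2 (uvuv #3 #1) 2 ∷ bySuffix 3 (uvuv #3 #0) 2 ∷ bySuffix 4 (uvuv #2 #3) 1 ∷ []) , (single #3 ∷ triple #0 #1 ∷ single #2 ∷ []))
    ∷ (true ∷ true ∷ false ∷ false ∷ false ∷ true ∷ [] , (bySuffix 1 (uvuvuv #1 #0) 4 ∷ byPrefix 1 (uvuvwvuwu #0 #1 #2) 5 ∷ bySuffix 0 (uu #0) 0 ∷ bySuffix 2 (uvuvuv #1 #3) 4 ∷ byPrefix 2 (uvuvwvuwu #3 #1 #0) 4 ∷ bySuffix 1 (uvuvuv #0 #3) 2 ∷ []) , (single #2 ∷ single #3 ∷ triple #0 #1 ∷ []))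
    ∷ (true ∷ true ∷ false ∷ false ∷ true ∷ false ∷ [] , (byPrefix 2 (uvuvuv #0 #3) 1 ∷ bySuffix 0 (uvuvwvuwu #3 #1 #0) 4 ∷ bySuffix 4 (uvuvwvuwu #3 #0 #2) 5 ∷ bySuffix 3 (uvuv #3 #2) 2 ∷ bySuffix 4 (uvuvuv #0 #3) 1 ∷ []) , (triple #1 #3 ∷ single #2 ∷ single #0 ∷ []))
    ∷ (true ∷ true ∷ false ∷ false ∷ true ∷ true ∷ [] , (bySuffix 0 (uu #1) 2 ∷ byPrefix 1 (uvuvwvuwu #1 #0 #3) 4 ∷ bySuffix 0 (uu #1) 0 ∷ bySuffix 3 (uvuv #2 #3) 1 ∷ []) , (single #3 ∷ single #1 ∷ single #0 ∷ single #2 ∷ []))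
    ∷ (true ∷ true ∷ false ∷ true ∷ false ∷ false ∷ [] , (bySuffix 0 (uvuvwvuwu #0 #2 #1) 6 ∷ bySuffix 2 (uvuvuv #0 #2) 1 ∷ byPrefix 1 (uvuv #1 #3) 1 ∷ bySuffix 3 (uvuv #0 #3) 1 ∷ []) , (single #2 ∷ single #3 ∷ single #1 ∷ single #0 ∷ []))
    ∷ (true ∷ true ∷ false ∷ true ∷ false ∷ true ∷ [] , (bySuffix 0 (uvuvwvuwu #0 #2 #1) 6 ∷ bySuffix 2 (uvuvuv #0 #2) 1 ∷ byPrefix 1 (uvuvuv #1 #3) 1 ∷ byPrefix 2 (uvuvwvuwu #1 #3 #0) 6 ∷ []) , (single #2 ∷ single #3 ∷ triple #1 #0 ∷ []))
    ∷ (true ∷ true ∷ false ∷ true ∷ true ∷ false ∷ [] , (bySuffix 3 (uvuvuv #2 #3) 4 ∷ byPrefix 3 (uvuvwvuwu #3 #2 #0) 4 ∷ byPrefix 2 (uvuvwvuwu #0 #3 #1) 4 ∷ byPrefix 0 (uvuvuv #0 #1) 5 ∷ []) , (triple #1 #3 ∷ single #2 ∷ single #0 ∷ []))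
    ∷ (true ∷ true ∷ false ∷ true ∷ true ∷ true ∷ [] , (bySuffix 0 (uu #1) 2 ∷ byPrefix 1 (uvuvwvuwu #1 #0 #3) 4 ∷ bySuffix 0 (uu #1) 0 ∷ bySuffix 3 (uvuv #2 #3) 1 ∷ []) , (single #3 ∷ single #1 ∷ single #0 ∷ single #2 ∷ []))
    ∷ (true ∷ true ∷ true ∷ false ∷ false ∷ false ∷ [] , (bySuffix 1 (uvuvuv #1 #0) 4 ∷ byPrefix 1 (uvuvwvuwu #0 #1 #3) 4 ∷ bySuffix 0 (uu #0) 0 ∷ bySuffix 3 (uvuv #2 #3) 1 ∷ []) , (single #3 ∷ single #0 ∷ single #1 ∷ single #2 ∷ []))
    ∷ (true ∷ true ∷ true ∷ false ∷ false ∷ true ∷ [] , (byPrefix 0 (uvuvuv #0 #1) 3 ∷ bySuffix 2 (uvuvuv #1 #2) 4 ∷ bySuffix 0 (uvuvwvuwu #2 #0 #1) 4 ∷ byPrefix 0 (uvuvwvuwu #0 #2 #3) 4 ∷ bySuffix 4 (uvuv #1 #3) 1 ∷ []) , (triple #0 #3 ∷ single #2 ∷ single #1 ∷ []))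
    ∷ (true ∷ true ∷ true ∷ false ∷ true ∷ false ∷ [] , (byPrefix 2 (uvuvuv #0 #3) 1 ∷ byPrefix 3 (uvuvwvuwu #0 #3 #2) 6 ∷ bySuffix 0 (uvuvuv #0 #1) 4 ∷ byPrefix 0 (uvuvwvuwu #1 #0 #3) 6 ∷ []) , (triple #1 #3 ∷ single #2 ∷ single #0 ∷ []))
    ∷ (true ∷ true ∷ true ∷ false ∷ true ∷ true ∷ [] , (bySuffix 0 (uvuvwvuwu #0 #3 #1) 6 ∷ bySuffix 2 (uvuvuv #3 #0) 2 ∷ bySuffix 3 (uvuv #2 #3) 1 ∷ []) , (single #3 ∷ single #1 ∷ single #0 ∷ single #2 ∷ []))
    ∷ (true ∷ true ∷ true ∷ true ∷ false ∷ false ∷ [] , (byPrefix 0 (uvuvuv #0 #1) 3 ∷ bySuffix 3 (uvuvuv #2 #3) 4 ∷ byPrefix 3 (uvuvwvuwu #3 #2 #1) 4 ∷ byPrefix 2 (uvuvwvuwu #1 #3 #0) 4 ∷ bySuffix 0 (uvuvuv #0 #1) 1 ∷ []) , (triple #0 #3 ∷ single #2 ∷ single #1 ∷ []))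
    ∷ (true ∷ true ∷ true ∷ true ∷ false ∷ true ∷ [] , (bySuffix 1 (uvuvuv #1 #0) 4 ∷ byPrefix 1 (uvuvwvuwu #0 #1 #3) 4 ∷ bySuffix 0 (uu #0) 0 ∷ bySuffix 3 (uvuv #2 #3) 1 ∷ []) , (single #3 ∷ single #0 ∷ single #1 ∷ single #2 ∷ []))
    ∷ (true ∷ true ∷ true ∷ true ∷ true ∷ false ∷ [] , (bySuffix 0 (uvuvwvuwu #0 #3 #1) 6 ∷ bySuffix 2 (uvuvuv #3 #0) 2 ∷ bySuffix 3 (uvuv #2 #3) 1 ∷ []) , (single #3 ∷ single #1 ∷ single #0 ∷ single #2 ∷ []))
    ∷ (true ∷ true ∷ true ∷ true ∷ true ∷ true ∷ [] , (byPrefix 0 (uvuvwvuwu #0 #1 #2) 3 ∷ bySuffix 3 (uvuvuv #1 #2) 2 ∷ byPrefix 0 (uvuvwvuwu #0 #2 #3) 4 ∷ bySuffix 4 (uvuv #1 #3) 1 ∷ []) , (triple #0 #3 ∷ single #2 ∷ single #1 ∷ []))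
    ∷ []

module _ {G : Graph n} (simple : IsSimple G) (vs : Vec (Fin n) k) (distinct : Unique vs) where

  private
    ι : Fin k → Fin n
    ι = lookup vs

  FrontReducible-inContext : ∀ {pre pb u} → FrontReducible pre pb u → u ∈ pre ++ blocksWord pb →
    ∀ rest → BlocksOK (G · map ι pre) (map (mapBlock ι) pb ++ rest) →
    AllPairs Disjoint (map blockWord (map (mapBlock ι) pb ++ rest)) →
    Disjoint (map ι pre) (blocksWord rest) →
    FrontReduct G (map ι pre ++ blocksWord (map (mapBlock ι) pb ++ rest)) (ι u)
  FrontReducible-inContext {pre} {pb} {u} reducible u∈ rest valid disjoint pre∩rest =
    subst (λ w → FrontReduct G w (ι u)) (sym word-++)
      (FrontReduct-++ simple (subst (λ w → FrontReduct G w (ι u)) word front) rest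
        (subst (λ H → BlocksOK H rest) (sym (·-++ G (map ι pre) (blocksWord pbι))) valid-rest)
        (AllPairs-++⁻ʳ (map blockWord pbι) disjoint′) w∩rest (subst (ι u ∈_) word (∈-map⁺ ι u∈)))
    where
    pbι = map (mapBlock ι) pb
    w₀ = map ι pre ++ blocksWord pbι
    valid-pb = proj₁ (BlocksOK-++⁻ (G · map ι pre) pbι rest valid)
    valid-rest = proj₂ (BlocksOK-++⁻ (G · map ι pre) pbι rest valid)
    disjoint′ : AllPairs Disjoint (map blockWord pbι ++ map blockWord rest)
    disjoint′ = subst (AllPairs Disjoint) (map-++ blockWord pbι rest) disjoint
    front : FrontReduct G (map ι (pre ++ blocksWord pb)) (ι u)
    front = FrontReduct-embed distinct
      (FrontReducible.frontReduce reducible (restrict G vs) (restrict-simple simple vs)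
        (BlocksOK-cong (restrict-· distinct G pre) pb (BlocksOK-restrict distinct pb valid-pb)))
    word : map ι (pre ++ blocksWord pb) ≡ w₀
    word = trans (map-++ ι pre (blocksWord pb)) (cong (map ι pre ++_) (sym (blocksWord-map ι pb)))
    word-++ : map ι pre ++ blocksWord (pbι ++ rest) ≡ w₀ ++ blocksWord rest
    word-++ = trans (cong (map ι pre ++_) (blocksWord-++ pbι rest)) (sym (++-assoc (map ι pre) _ _))
    w∩rest : Disjoint w₀ (blocksWord rest)
    w∩rest (z∈w , z∈rest) with ∈-++⁻ (map ι pre) z∈w
    ... | inj₁ z∈pre = pre∩rest (z∈pre , z∈rest)
    ... | inj₂ z∈pb  = AllPairs-Disjoint-++ (map blockWord pbι) disjoint′ (z∈pb , z∈rest)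

data Front {n} (u : Fin n) : List (Block n) → Set where
  absent        : ∀ {bs} → u ∉ blocksWord bs → Front u bs
  single-first  : ∀ bs → Front u (single u ∷ bs)
  triple-middle : ∀ d bs → Front u (triple d u ∷ bs)
  single-second : ∀ d bs → Front u (single d ∷ single u ∷ bs)

front : (u : Fin n) (bs : List (Block n)) → u ∉ drop 2 (blocksWord bs) → Front u bs
front u [] _ = absent λ ()
front u (single d ∷ bs) u∉ with d ≟ u
... | yes refl = single-first bs
front u (single d ∷ []) u∉ | no d≢u = absent λ { (here u≡d) → d≢u (sym u≡d) }
front u (single d ∷ single e ∷ bs) u∉ | no d≢u with e ≟ u
... | yes refl = single-second d bs
... | no e≢u =
  absent λ { (here u≡d) → d≢u (sym u≡d) ; (there (here u≡e)) → e≢u (sym u≡e) ; (there (there u∈)) → u∉ u∈ }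
front u (single d ∷ triple e f ∷ bs) u∉ | no d≢u =
  absent λ { (here u≡d) → d≢u (sym u≡d) ; (there u∈) → u∉ (rotate u∈) }
  where
  rotate : u ∈ e ∷ f ∷ e ∷ blocksWord bs → u ∈ f ∷ e ∷ blocksWord bs
  rotate (here u≡e)         = there (here u≡e)
  rotate (there (here u≡f)) = here u≡f
  rotate (there (there u∈)) = there u∈
front u (triple d e ∷ bs) u∉ with e ≟ u
... | yes refl = triple-middle d bs
... | no e≢u =
  absent λ { (here u≡d) → u∉ (here u≡d) ; (there (here u≡e)) → e≢u (sym u≡e) ; (there (there u∈)) → u∉ u∈ }

module _ {G : Graph n} (simple : IsSimple G) where

  FrontReduct-blockBeforeFront : (b : Block n) (bs : List (Block n)) → BlocksOK G (b ∷ bs) →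
    AllPairs Disjoint (map blockWord (b ∷ bs)) → ∀ {u} → u ∉ blockWord b → Front u bs →
    FrontReduct G (blockWord b ++ blocksWord bs) u
  FrontReduct-blockBeforeFront b bs valid disjoint u∉b (absent u∉bs) =
    Reduct-refl (b ∷ bs) valid disjoint ,
    λ u∈ → [ u∉b ∘ drop⊆ 2 (blockWord b) , u∉bs ]′ (∈-++⁻ _ (drop2-++ (blockWord b) _ u∈))
  FrontReduct-blockBeforeFront (single a) _ valid disjoint {u} u∉b (single-first bs) =
    FrontReducible-inContext simple (a ∷ u ∷ []) ((a≢u ∷ []) ∷ [] ∷ []) front-a·u
      (there (here refl)) bs valid disjoint (λ ())
    where a≢u = λ a≡u → u∉b (here (sym a≡u))
  FrontReduct-blockBeforeFront (single a) _ valid disjoint@(a∩ ∷ _) {u} u∉b (triple-middle d bs) =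
    FrontReducible-inContext simple (a ∷ d ∷ u ∷ []) ((a≢d ∷ a≢u ∷ []) ∷ (proj₁ valid ∷ []) ∷ [] ∷ [])
      front-a·dud (there (there (here refl))) bs valid disjoint (λ ())
    where a≢u = λ a≡u → u∉b (here (sym a≡u))
          a≢d = Disjoint⇒≢ (All.head a∩) (here refl) (here refl)
  FrontReduct-blockBeforeFront (single a) _ valid disjoint@(a∩ ∷ d∩ ∷ _) {u} u∉b (single-second d bs) =
    FrontReducible-inContext simple (a ∷ d ∷ u ∷ []) ((a≢d ∷ a≢u ∷ []) ∷ (d≢u ∷ []) ∷ [] ∷ [])
      front-a·d·u (there (there (here refl))) bs valid disjoint (λ ())
    where a≢u = λ a≡u → u∉b (here (sym a≡u))
          a≢d = Disjoint⇒≢ (All.head a∩) (here refl) (here refl)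
          d≢u = Disjoint⇒≢ (All.head d∩) (here refl) (here refl)
  FrontReduct-blockBeforeFront (triple a c) _ valid disjoint {u} u∉b (single-first bs) =
    FrontReducible-inContext simple (a ∷ c ∷ u ∷ []) ((proj₁ valid ∷ a≢u ∷ []) ∷ (c≢u ∷ []) ∷ [] ∷ [])
      front-aca·u (there (there (there (here refl)))) bs valid disjoint (λ ())
    where a≢u = λ a≡u → u∉b (here (sym a≡u))
          c≢u = λ c≡u → u∉b (there (here (sym c≡u)))
  FrontReduct-blockBeforeFront (triple a c) _ valid disjoint@(a∩ ∷ _) {u} u∉b (triple-middle d bs) =
    FrontReducible-inContext simple (a ∷ c ∷ d ∷ u ∷ [])
      ((proj₁ valid ∷ a≢d ∷ a≢u ∷ []) ∷ (c≢d ∷ c≢u ∷ []) ∷ (proj₁ (proj₂ (proj₂ valid)) ∷ []) ∷ [] ∷ [])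
      front-aca·dud (there (there (there (there (here refl))))) bs valid disjoint (λ ())
    where a≢u = λ a≡u → u∉b (here (sym a≡u))
          c≢u = λ c≡u → u∉b (there (here (sym c≡u)))
          a≢d = Disjoint⇒≢ (All.head a∩) (here refl) (here refl)
          c≢d = Disjoint⇒≢ (All.head a∩) (there (here refl)) (here refl)
  FrontReduct-blockBeforeFront (triple a c) _ valid disjoint@(a∩ ∷ d∩ ∷ _) {u} u∉b (single-second d bs) =
    FrontReducible-inContext simple (a ∷ c ∷ d ∷ u ∷ [])
      ((proj₁ valid ∷ a≢d ∷ a≢u ∷ []) ∷ (c≢d ∷ c≢u ∷ []) ∷ (d≢u ∷ []) ∷ [] ∷ [])
      front-aca·d·u (there (there (there (there (here refl))))) bs valid disjoint (λ ())
    where a≢u = λ a≡u → u∉b (here (sym a≡u))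
          c≢u = λ c≡u → u∉b (there (here (sym c≡u)))
          a≢d = Disjoint⇒≢ (All.head a∩) (here refl) (here refl)
          c≢d = Disjoint⇒≢ (All.head a∩) (there (here refl)) (here refl)
          d≢u = Disjoint⇒≢ (All.head d∩) (here refl) (here refl)

FrontReduct-prependBlock : IsSimple G → (b : Block n) (bs : List (Block n)) → BlocksOK G (b ∷ bs) →
  All (Disjoint (blockWord b)) (map blockWord bs) → ∀ {u} → u ∉ blockWord b →
  FrontReduct (G · blockWord b) (blocksWord bs) u → FrontReduct G (blocksWord (b ∷ bs)) u
FrontReduct-prependBlock simple b bs valid b∩ {u} u∉b (reduct bs₁ reaches₁ valid₁ disjoint₁ letters₁ , u∉) =
  FrontReduct-precompose (Loc-prefix (blockWord b) reaches₁) (Subset.++⁺ʳ (blockWord b) letters₁)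
    (FrontReduct-blockBeforeFront simple b bs₁ (BlocksOK-∷ b valid valid₁) (b∩₁ ∷ disjoint₁) u∉b
      (front u bs₁ u∉))
  where
  b∩₁ = Disjoint-concat⁺ λ (z∈b , z∈bs₁) → Disjoint-concat⁻ b∩ (z∈b , letters₁ z∈bs₁)

moveToFront : IsSimple G → ∀ bs → BlocksOK G bs → AllPairs Disjoint (map blockWord bs) → ∀ u →
  FrontReduct G (blocksWord bs) u
moveToFront simple [] _ _ u = Reduct-refl [] tt [] , λ ()
moveToFront simple (single c ∷ bs) valid disjoint@(c∩ ∷ disjoint′) u with c ≟ u
... | yes refl =
  Reduct-refl (single c ∷ bs) valid disjoint , λ u∈ → Disjoint-concat⁻ c∩ (here refl , drop⊆ 1 _ u∈)
... | no c≢u   = FrontReduct-prependBlock simple (single c) bs valid c∩ (λ { (here u≡c) → c≢u (sym u≡c) })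
                   (moveToFront (lc-simple simple c) bs valid disjoint′ u)
moveToFront simple (triple c d ∷ bs) valid disjoint@(c∩ ∷ disjoint′) u with c ≟ u | d ≟ u
... | yes refl | _        =
  FrontReducible-inContext simple (c ∷ d ∷ []) ((proj₁ valid ∷ []) ∷ [] ∷ []) front-udu
    (here refl) bs valid disjoint (λ ())
... | no c≢u   | yes refl =
  Reduct-refl (triple c d ∷ bs) valid disjoint ,
  λ { (here u≡c) → c≢u (sym u≡c) ; (there u∈) → Disjoint-concat⁻ c∩ (there (here refl) , u∈) }
... | no c≢u   | no d≢u   =
  FrontReduct-prependBlock simple (triple c d) bs valid c∩
    (λ { (here u≡c) → c≢u (sym u≡c) ; (there (here u≡d)) → d≢u (sym u≡d)
       ; (there (there (here u≡c))) → c≢u (sym u≡c) })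
    (moveToFront (·-simple simple (c ∷ d ∷ c ∷ [])) bs (proj₂ (proj₂ valid)) disjoint′ u)

Reduct-prependLetter : IsSimple G → (x : Fin n) (bs : List (Block n)) → BlocksOK (lc G x) bs →
  AllPairs Disjoint (map blockWord bs) → Front x bs → Reduct G (x ∷ blocksWord bs)
Reduct-prependLetter simple x bs valid disjoint (absent x∉) =
  reduct (single x ∷ bs) ε valid (Disjoint-concat⁺ (λ { (here refl , x∈) → x∉ x∈ }) ∷ disjoint) (λ z∈ → z∈)
Reduct-prependLetter simple x _ valid disjoint@(x∩ ∷ _) (single-first bs) =
  proj₁ (FrontReducible-inContext simple (x ∷ []) ([] ∷ []) reducible-x·x (here refl) bs valid disjoint
    λ { (here refl , x∈) → Disjoint-concat⁻ x∩ (here refl , x∈) })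
Reduct-prependLetter simple x _ valid disjoint@(x∩ ∷ _) (triple-middle d bs) =
  proj₁ (FrontReducible-inContext simple (x ∷ d ∷ []) ((x≢d ∷ []) ∷ [] ∷ []) reducible-x·dxd (there (here refl))
    bs valid disjoint λ { (here refl , x∈) → Disjoint-concat⁻ x∩ (there (here refl) , x∈) })
  where x≢d = λ x≡d → proj₁ valid (sym x≡d)
Reduct-prependLetter simple x _ valid disjoint@(d∩ ∷ x∩ ∷ _) (single-second d bs) =
  proj₁ (FrontReducible-inContext simple (x ∷ d ∷ []) ((x≢d ∷ []) ∷ [] ∷ []) reducible-x·d·x (there (here refl))
    bs valid disjoint λ { (here refl , x∈) → Disjoint-concat⁻ x∩ (here refl , x∈) })
  where x≢d = λ x≡d → Disjoint⇒≢ (All.head d∩) (here refl) (here refl) (sym x≡d)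

reduce : IsSimple G → ∀ s → Reduct G s
reduce simple [] = Reduct-refl [] tt []
reduce simple (x ∷ s) with reduce (lc-simple simple x) s
... | reduct bs₀ reaches₀ valid₀ disjoint₀ letters₀ with moveToFront (lc-simple simple x) bs₀ valid₀ disjoint₀ x
... | reduct bs₁ reaches₁ valid₁ disjoint₁ letters₁ , x∉ =
  Reduct-precompose (Loc-prefix (x ∷ []) (reaches₀ ◅◅ reaches₁)) (Subset.∷⁺ʳ x (letters₀ ∘ letters₁))
    (Reduct-prependLetter simple x bs₁ valid₁ disjoint₁ (front x bs₁ x∉))

frontReduce : IsSimple G → ∀ s u → FrontReduct G s u
frontReduce simple s u with reduce simple s
... | reduct bs reaches valid disjoint letters =
  FrontReduct-precompose reaches letters (moveToFront simple bs valid disjoint u)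

∉-drop2⇒OnlyAtStart : {u : Fin n} (s : Word n) → u ∉ drop 2 s → OnlyAtStart u s
∉-drop2⇒OnlyAtStart (a ∷ s)     u∉ zero          _   = s≤s z≤n
∉-drop2⇒OnlyAtStart (a ∷ b ∷ s) u∉ (suc zero)    _   = s≤s (s≤s z≤n)
∉-drop2⇒OnlyAtStart (a ∷ b ∷ s) u∉ (suc (suc i)) s≡u = ⊥-elim (u∉ (subst (_∈ s) s≡u (∈-lookup i)))

theorem1p3p10 : ∀ (n : ℕ) (G : Graph n) → IsSimple G →
    ∀ (s : Word n) (u : Fin n) →
    Σ (Word n) λ s' → Loc G s s' × Reduced G s' × s' ⊆ s × OnlyAtStart u s'
theorem1p3p10 n G simple s u with frontReduce simple s u
... | reduct bs reaches valid disjoint letters , u∉ =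
  blocksWord bs , reaches , (bs , refl , disjoint , valid) , letters , ∉-drop2⇒OnlyAtStart (blocksWord bs) u∉
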